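{- Let $k\ge0$ and let $X$ be a set of sentences of the language of $\mathsf{HA}$ all belonging to $\mathcal{Q}_{k+1}$. For all formulas $\varphi\in\mathcal{V}_{k+1}$ and $\psi\in\mathcal{Q}_{k+1}$, if $\mathsf{PA}+X\vdash\psi\to\varphi$, then $\mathsf{HA}+X+\mathrm{LEM}(\Sigma_k)\vdash\psi\to\varphi$.
   Context: $\mathsf{HA}$ is intuitionistic first-order arithmetic with function symbols for all primitive recursive functions and logical constants $\forall,\exists,\to,\land,\lor,\perp$ ($\neg\varphi:\equiv\varphi\to\perp$); $\mathsf{PA}$ is $\mathsf{HA}$ plus the law of excluded middle for all formulas; $T+X$ denotes $T$ with the sentences of $X$ added as axioms. $\Sigma_0=\Pi_0$ is the class of quantifier-free formulas; $\Sigma_{k+1}$ consists of formulas $\exists x_1\cdots\exists x_n\varphi$ with $\varphi\in\Pi_k$, $\Pi_{k+1}$ of formulas $\forall x_1\cdots\forall x_n\varphi$ with $\varphi\in\Sigma_k$. $\mathrm{LEM}(\Sigma_k)$ is the scheme $\varphi\lor\neg\varphi$, $\varphi\in\Sigma_k$. Degree: an alternation path is a finite sequence of symbols $+,-$ in which they alternate; $i(s)$ is the first symbol of $s$ if nonempty and $\times$ if empty, $s^\perp$ swaps $+$ and $-$, $l(s)$ is the length. $\mathrm{Alt}(\varphi)=\{\langle\rangle\}$ if $\varphi$ is quantifier-free; otherwise $\mathrm{Alt}(\varphi_1\land\varphi_2)=\mathrm{Alt}(\varphi_1\lor\varphi_2)=\mathrm{Alt}(\varphi_1)\cup\mathrm{Alt}(\varphi_2)$,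 $\mathrm{Alt}(\varphi_1\to\varphi_2)=\{s^\perp:s\in\mathrm{Alt}(\varphi_1)\}\cup\mathrm{Alt}(\varphi_2)$, $\mathrm{Alt}(\forall x\varphi_1)=\{s\in\mathrm{Alt}(\varphi_1):i(s)=-\}\cup\{ -s:s\in\mathrm{Alt}(\varphi_1),i(s)\ne-\}$, $\mathrm{Alt}(\exists x\varphi_1)=\{s\in\mathrm{Alt}(\varphi_1):i(s)=+\}\cup\{+s:s\in\mathrm{Alt}(\varphi_1),i(s)\ne+\}$. $\deg(\varphi)=\max\{l(s):s\in\mathrm{Alt}(\varphi)\}$; $\mathrm{F}_k^+$ is the class of formulas of degree $\le k$. Classes: $\mathcal{R}_0=\mathcal{J}_0=\Sigma_0$; $\mathcal{R}_{k+1},\mathcal{J}_{k+1}$ are simultaneously generated by: every formula of $\mathrm{F}_k^+$ is in both; for $R,R'\in\mathcal{R}_{k+1}$, $J,J'\in\mathcal{J}_{k+1}$: $R\land R',R\lor R',\forall xR,J\to R\in\mathcal{R}_{k+1}$ and $J\land J',J\lor J',\exists xJ,R\to J\in\mathcal{J}_{k+1}$. $\mathcal{Q}_0=\Sigma_0$; $\mathcal{Q}_{k+1}$ is generated by prime formulas and closure under $Q\land Q',Q\lor Q',\forall xQ,\exists xQ$, and $J\to Q$ for $J\in\mathcal{J}_{k+1}$. $\mathcal{V}_{k+1}$ is generated by $\mathcal{J}_{k+1}$ and closure under $\land$ and $\forall x$. -}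

module Defs where

open import Data.Nat using (ℕ; zero; suc; _<_; _≤_; _⊔_)
open import Data.Fin using (Fin)
open import Data.Vec using (Vec; []; _∷_; lookup)
import Data.Vec as Vec
open import Data.List using (List; []; _∷_; _++_; length; foldr)
import Data.List as List
open import Data.List.Membership.Propositional using (_∈_)
open import Data.Bool using (Bool; true; false; _∧_; if_then_else_)
open import Relation.Binary.PropositionalEquality using (_≡_)

data PR : ℕ → Set where
  Zr   : PR 0
  Sc   : PR 1
  Pj   : ∀ {n} → Fin n → PR n
  Cmp  : ∀ {m n} → PR m → Vec (PR n) m → PR n
  Rec  : ∀ {n} → PR n → PR (suc (suc n)) → PR (suc n)

-- Terms and formulas (de Bruijn variables)

data Term : Set where
  var : ℕ → Term
  fn  : ∀ {n} → PR n → Vec Term n → Term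

infix  7 _≐_
infixr 6 _∧'_
infixr 5 _∨'_
infixr 4 _⇒_

data Form : Set where
  _≐_  : Term → Term → Form
  ⊥'   : Form
  _∧'_ : Form → Form → Form
  _∨'_ : Form → Form → Form
  _⇒_  : Form → Form → Form
  ∀'   : Form → Form
  ∃'   : Form → Form

¬'_ : Form → Form
¬' φ = φ ⇒ ⊥'

zero' : Term
zero' = fn Zr []

S' : Term → Term
S' t = fn Sc (t ∷ [])

mutual
  renT : (ℕ → ℕ) → Term → Term
  renT ρ (var i)  = var (ρ i)
  renT ρ (fn f ts) = fn f (renTs ρ ts)

  renTs : ∀ {n} → (ℕ → ℕ) → Vec Term n → Vec Term n
  renTs ρ []       = []
  renTs ρ (t ∷ ts) = renT ρ t ∷ renTs ρ ts

liftR : (ℕ → ℕ) → ℕ → ℕ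
liftR ρ zero    = zero
liftR ρ (suc i) = suc (ρ i)

renF : (ℕ → ℕ) → Form → Form
renF ρ (t ≐ s)  = renT ρ t ≐ renT ρ s
renF ρ ⊥'       = ⊥'
renF ρ (φ ∧' ψ) = renF ρ φ ∧' renF ρ ψ
renF ρ (φ ∨' ψ) = renF ρ φ ∨' renF ρ ψ
renF ρ (φ ⇒ ψ)  = renF ρ φ ⇒ renF ρ ψ
renF ρ (∀' φ)   = ∀' (renF (liftR ρ) φ)
renF ρ (∃' φ)   = ∃' (renF (liftR ρ) φ)

↑ : Form → Form
↑ = renF suc

mutual
  subT : (ℕ → Term) → Term → Term
  subT σ (var i)   = σ i
  subT σ (fn f ts) = fn f (subTs σ ts)

  subTs : ∀ {n} → (ℕ → Term) → Vec Term n → Vec Term n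
  subTs σ []       = []
  subTs σ (t ∷ ts) = subT σ t ∷ subTs σ ts

liftS : (ℕ → Term) → ℕ → Term
liftS σ zero    = var zero
liftS σ (suc i) = renT suc (σ i)

subF : (ℕ → Term) → Form → Form
subF σ (t ≐ s)  = subT σ t ≐ subT σ s
subF σ ⊥'       = ⊥'
subF σ (φ ∧' ψ) = subF σ φ ∧' subF σ ψ
subF σ (φ ∨' ψ) = subF σ φ ∨' subF σ ψ
subF σ (φ ⇒ ψ)  = subF σ φ ⇒ subF σ ψ
subF σ (∀' φ)   = ∀' (subF (liftS σ) φ)
subF σ (∃' φ)   = ∃' (subF (liftS σ) φ)

-- substitution of t for variable 0 (other variables shift down by one)
inst : Term → ℕ → Term
inst t zero    = t
inst t (suc i) = var i

_[_] : Form → Term → Form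
φ [ t ] = subF (inst t) φ

succ0 : ℕ → Term
succ0 zero    = S' (var zero)
succ0 (suc i) = var (suc i)

mutual
  data ScopedT (n : ℕ) : Term → Set where
    var : ∀ {i} → i < n → ScopedT n (var i)
    fn  : ∀ {m} {f : PR m} {ts} → ScopedTs n ts → ScopedT n (fn f ts)

  data ScopedTs (n : ℕ) : ∀ {m} → Vec Term m → Set where
    []  : ScopedTs n []
    _∷_ : ∀ {m t} {ts : Vec Term m} → ScopedT n t → ScopedTs n ts → ScopedTs n (t ∷ ts)

data Scoped : ℕ → Form → Set where
  eq  : ∀ {n t s} → ScopedT n t → ScopedT n s → Scoped n (t ≐ s)
  bot : ∀ {n} → Scoped n ⊥'
  and : ∀ {n φ ψ} → Scoped n φ → Scoped n ψ → Scoped n (φ ∧' ψ)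
  or  : ∀ {n φ ψ} → Scoped n φ → Scoped n ψ → Scoped n (φ ∨' ψ)
  imp : ∀ {n φ ψ} → Scoped n φ → Scoped n ψ → Scoped n (φ ⇒ ψ)
  all : ∀ {n φ} → Scoped (suc n) φ → Scoped n (∀' φ)
  ex  : ∀ {n φ} → Scoped (suc n) φ → Scoped n (∃' φ)

Sentence : Form → Set
Sentence = Scoped 0

infix 2 _⊢[_]_

data _⊢[_]_ (Γ : List Form) (T : Form → Set) : Form → Set where
  hyp   : ∀ {φ} → φ ∈ Γ → Γ ⊢[ T ] φ
  ax    : ∀ {φ} → T φ → Γ ⊢[ T ] φ
  ∧I    : ∀ {φ ψ} → Γ ⊢[ T ] φ → Γ ⊢[ T ] ψ → Γ ⊢[ T ] φ ∧' ψ
  ∧E₁   : ∀ {φ ψ} → Γ ⊢[ T ] φ ∧' ψ → Γ ⊢[ T ] φ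
  ∧E₂   : ∀ {φ ψ} → Γ ⊢[ T ] φ ∧' ψ → Γ ⊢[ T ] ψ
  ∨I₁   : ∀ {φ ψ} → Γ ⊢[ T ] φ → Γ ⊢[ T ] φ ∨' ψ
  ∨I₂   : ∀ {φ ψ} → Γ ⊢[ T ] ψ → Γ ⊢[ T ] φ ∨' ψ
  ∨E    : ∀ {φ ψ χ} → Γ ⊢[ T ] φ ∨' ψ → (φ ∷ Γ) ⊢[ T ] χ → (ψ ∷ Γ) ⊢[ T ] χ → Γ ⊢[ T ] χ
  ⇒I    : ∀ {φ ψ} → (φ ∷ Γ) ⊢[ T ] ψ → Γ ⊢[ T ] φ ⇒ ψ
  ⇒E    : ∀ {φ ψ} → Γ ⊢[ T ] φ ⇒ ψ → Γ ⊢[ T ] φ → Γ ⊢[ T ] ψ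
  ⊥E    : ∀ {φ} → Γ ⊢[ T ] ⊥' → Γ ⊢[ T ] φ
  ∀I    : ∀ {φ} → List.map ↑ Γ ⊢[ T ] φ → Γ ⊢[ T ] ∀' φ
  ∀E    : ∀ {φ} (t : Term) → Γ ⊢[ T ] ∀' φ → Γ ⊢[ T ] φ [ t ]
  ∃I    : ∀ {φ} (t : Term) → Γ ⊢[ T ] φ [ t ] → Γ ⊢[ T ] ∃' φ
  ∃E    : ∀ {φ χ} → Γ ⊢[ T ] ∃' φ → (φ ∷ List.map ↑ Γ) ⊢[ T ] ↑ χ → Γ ⊢[ T ] χ
  refl≐ : ∀ t → Γ ⊢[ T ] t ≐ t
  subst≐ : ∀ φ {t s} → Γ ⊢[ T ] t ≐ s → Γ ⊢[ T ] φ [ t ] → Γ ⊢[ T ] φ [ s ]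
  S≠0   : ∀ t → Γ ⊢[ T ] ¬' (S' t ≐ zero')
  S-inj : ∀ t s → Γ ⊢[ T ] S' t ≐ S' s ⇒ t ≐ s
  def-Pj  : ∀ {n} (i : Fin n) (ts : Vec Term n) → Γ ⊢[ T ] fn (Pj i) ts ≐ lookup ts i
  def-Cmp : ∀ {m n} (f : PR m) (gs : Vec (PR n) m) (ts : Vec Term n) →
            Γ ⊢[ T ] fn (Cmp f gs) ts ≐ fn f (Vec.map (λ g → fn g ts) gs)
  def-Rec0 : ∀ {n} (f : PR n) (g : PR (suc (suc n))) (ts : Vec Term n) →
             Γ ⊢[ T ] fn (Rec f g) (zero' ∷ ts) ≐ fn f ts
  def-RecS : ∀ {n} (f : PR n) (g : PR (suc (suc n))) (t : Term) (ts : Vec Term n) →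
             Γ ⊢[ T ] fn (Rec f g) (S' t ∷ ts) ≐ fn g (t ∷ fn (Rec f g) (t ∷ ts) ∷ ts)
  -- induction scheme (variable 0 is the induction variable)
  ind   : ∀ φ → Γ ⊢[ T ] (φ [ zero' ] ∧' ∀' (φ ⇒ subF succ0 φ)) ⇒ ∀' φ

isQF : Form → Bool
isQF (t ≐ s)  = true
isQF ⊥'       = true
isQF (φ ∧' ψ) = isQF φ ∧ isQF ψ
isQF (φ ∨' ψ) = isQF φ ∧ isQF ψ
isQF (φ ⇒ ψ)  = isQF φ ∧ isQF ψ
isQF (∀' φ)   = false
isQF (∃' φ)   = false

QF : Form → Set
QF φ = isQF φ ≡ true

mutual
  data Sig : ℕ → Form → Set where
    sig0 : ∀ {φ} → QF φ → Sig 0 φ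
    sigB : ∀ {k φ} → Pi k φ → Sig (suc k) φ
    sig∃ : ∀ {k φ} → Sig (suc k) φ → Sig (suc k) (∃' φ)

  data Pi : ℕ → Form → Set where
    pi0 : ∀ {φ} → QF φ → Pi 0 φ
    piB : ∀ {k φ} → Sig k φ → Pi (suc k) φ
    pi∀ : ∀ {k φ} → Pi (suc k) φ → Pi (suc k) (∀' φ)

data PAX (X : Form → Set) : Form → Set where
  fromX : ∀ {φ} → X φ → PAX X φ
  lem   : ∀ φ → PAX X (φ ∨' ¬' φ)

data HAXLEM (X : Form → Set) (k : ℕ) : Form → Set where
  fromX : ∀ {φ} → X φ → HAXLEM X k φ
  lem   : ∀ {φ} → Sig k φ → HAXLEM X k (φ ∨' ¬' φ)

data Sym : Set where
  plus minus : Sym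

swap : Sym → Sym
swap plus  = minus
swap minus = plus

isHead : Sym → List Sym → Bool
isHead plus  (plus ∷ _)  = true
isHead minus (minus ∷ _) = true
isHead _     _           = false

addQ : Sym → List Sym → List Sym
addQ c s = if isHead c s then s else (c ∷ s)

Alt : Form → List (List Sym)
Alt φ with isQF φ
... | true = [] ∷ []
Alt (t ≐ s)  | false = [] ∷ []
Alt ⊥'       | false = [] ∷ []
Alt (φ ∧' ψ) | false = Alt φ ++ Alt ψ
Alt (φ ∨' ψ) | false = Alt φ ++ Alt ψ
Alt (φ ⇒ ψ)  | false = List.map (List.map swap) (Alt φ) ++ Alt ψ
Alt (∀' φ)   | false = List.map (addQ minus) (Alt φ)
Alt (∃' φ)   | false = List.map (addQ plus) (Alt φ)

deg : Form → ℕ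
deg φ = foldr _⊔_ 0 (List.map length (Alt φ))

F⁺ : ℕ → Form → Set
F⁺ k φ = deg φ ≤ k

mutual
  data R : ℕ → Form → Set where
    r0 : ∀ {φ} → QF φ → R 0 φ
    rF : ∀ {k φ} → F⁺ k φ → R (suc k) φ
    r∧ : ∀ {k φ ψ} → R (suc k) φ → R (suc k) ψ → R (suc k) (φ ∧' ψ)
    r∨ : ∀ {k φ ψ} → R (suc k) φ → R (suc k) ψ → R (suc k) (φ ∨' ψ)
    r∀ : ∀ {k φ} → R (suc k) φ → R (suc k) (∀' φ)
    r⇒ : ∀ {k φ ψ} → J (suc k) φ → R (suc k) ψ → R (suc k) (φ ⇒ ψ)

  data J : ℕ → Form → Set where
    j0 : ∀ {φ} → QF φ → J 0 φ
    jF : ∀ {k φ} → F⁺ k φ → J (suc k) φ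
    j∧ : ∀ {k φ ψ} → J (suc k) φ → J (suc k) ψ → J (suc k) (φ ∧' ψ)
    j∨ : ∀ {k φ ψ} → J (suc k) φ → J (suc k) ψ → J (suc k) (φ ∨' ψ)
    j∃ : ∀ {k φ} → J (suc k) φ → J (suc k) (∃' φ)
    j⇒ : ∀ {k φ ψ} → R (suc k) φ → J (suc k) ψ → J (suc k) (φ ⇒ ψ)

data Prime : Form → Set where
  p≐ : ∀ t s → Prime (t ≐ s)
  p⊥ : Prime ⊥'

data Q : ℕ → Form → Set where
  q0 : ∀ {φ} → QF φ → Q 0 φ
  qP : ∀ {k φ} → Prime φ → Q (suc k) φ
  q∧ : ∀ {k φ ψ} → Q (suc k) φ → Q (suc k) ψ → Q (suc k) (φ ∧' ψ)
  q∨ : ∀ {k φ ψ} → Q (suc k) φ → Q (suc k) ψ → Q (suc k) (φ ∨' ψ)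
  q∀ : ∀ {k φ} → Q (suc k) φ → Q (suc k) (∀' φ)
  q∃ : ∀ {k φ} → Q (suc k) φ → Q (suc k) (∃' φ)
  q⇒ : ∀ {k φ ψ} → J (suc k) φ → Q (suc k) ψ → Q (suc k) (φ ⇒ ψ)

data V : ℕ → Form → Set where
  vJ : ∀ {k φ} → J (suc k) φ → V (suc k) φ
  v∧ : ∀ {k φ ψ} → V (suc k) φ → V (suc k) ψ → V (suc k) (φ ∧' ψ)
  v∀ : ∀ {k φ} → V (suc k) φ → V (suc k) (∀' φ)

module Submission where

-- Read the classical proof of ψ ⇒ φ through the Gödel–Gentzen negative translation in which ⊥ is
-- replaced by a formula D (Friedman's trick); it is sound from PA + X into HA + X + LEM(Σₖ) as soon
-- as the axioms of X imply their own translations.  In HA + LEM(Σₖ) every formula of degree ≤ k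
-- is decidable, since its maximal quantified subformulas have Σₖ or Πₖ prenex forms, and on such
-- formulas the translation does not change the meaning.  Building on this, a Q-formula implies
-- its translation, and the translation of a J-formula A gives (A ⇒ D) ⇒ D.  The first fact
-- applies to ψ and the axioms of X; the second, with D := φ, recovers φ.  A V-formula is
-- assembled from J-formulas by ∧ and ∀.

open import Defs
open import Data.Nat using (ℕ; zero; suc; _≤_; _<_; _⊔_; z≤n; s≤s)
open import Data.Nat.Properties using (≤-trans; ≤-refl; n≤1+n; m≤m⊔n; m≤n⊔m)
import Data.Fin as Fin
open import Data.Vec using (Vec; []; _∷_; lookup)
import Data.Vec as Vec
open import Data.List using (List; []; _∷_; _++_; length)
import Data.List as List
open import Data.List.Properties using (length-map)
open import Data.List.Membership.Propositional using (_∈_)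
open import Data.List.Membership.Propositional.Properties using (∈-map⁺; ∈-++⁺ˡ; ∈-++⁺ʳ)
open import Data.List.Relation.Binary.Subset.Propositional using (_⊆_)
open import Data.List.Relation.Binary.Subset.Propositional.Properties using (∷⁺ʳ)
import Data.List.Relation.Binary.Subset.Propositional.Properties as ⊆
open import Data.List.Relation.Unary.Any using (here; there)
open import Data.List.Relation.Unary.All using (All; []; _∷_)
import Data.List.Relation.Unary.All as All
open import Data.List.Relation.Unary.All.Properties using (++⁻; ++⁺; map⁻; map⁺)
open import Data.Bool using (true; false; _∧_)
open import Data.Bool.Properties using (∧-conicalˡ; ∧-conicalʳ)
open import Data.Unit using (⊤; tt)
open import Data.Product using (∃; _×_; _,_; proj₁; proj₂)
open import Function using (_∘_)
open import Relation.Nullary using (contradiction)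
open import Relation.Binary.PropositionalEquality
  using (_≡_; refl; sym; trans; cong; cong₂; subst; subst₂; _≗_)

mutual
  renT-cong : ∀ {ρ ρ′} → ρ ≗ ρ′ → renT ρ ≗ renT ρ′
  renT-cong h (var i)   = cong var (h i)
  renT-cong h (fn f ts) = cong (fn f) (renTs-cong h ts)

  renTs-cong : ∀ {n ρ ρ′} → ρ ≗ ρ′ → (ts : Vec Term n) → renTs ρ ts ≡ renTs ρ′ ts
  renTs-cong h []       = refl
  renTs-cong h (t ∷ ts) = cong₂ _∷_ (renT-cong h t) (renTs-cong h ts)

mutual
  subT-cong : ∀ {σ σ′} → σ ≗ σ′ → subT σ ≗ subT σ′
  subT-cong h (var i)   = h i
  subT-cong h (fn f ts) = cong (fn f) (subTs-cong h ts)

  subTs-cong : ∀ {n σ σ′} → σ ≗ σ′ → (ts : Vec Term n) → subTs σ ts ≡ subTs σ′ ts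
  subTs-cong h []       = refl
  subTs-cong h (t ∷ ts) = cong₂ _∷_ (subT-cong h t) (subTs-cong h ts)

mutual
  renT-∘ : ∀ ρ ρ′ t → renT ρ (renT ρ′ t) ≡ renT (ρ ∘ ρ′) t
  renT-∘ ρ ρ′ (var i)   = refl
  renT-∘ ρ ρ′ (fn f ts) = cong (fn f) (renTs-∘ ρ ρ′ ts)

  renTs-∘ : ∀ {n} ρ ρ′ (ts : Vec Term n) → renTs ρ (renTs ρ′ ts) ≡ renTs (ρ ∘ ρ′) ts
  renTs-∘ ρ ρ′ []       = refl
  renTs-∘ ρ ρ′ (t ∷ ts) = cong₂ _∷_ (renT-∘ ρ ρ′ t) (renTs-∘ ρ ρ′ ts)

mutual
  subT-renT : ∀ σ ρ t → subT σ (renT ρ t) ≡ subT (σ ∘ ρ) t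
  subT-renT σ ρ (var i)   = refl
  subT-renT σ ρ (fn f ts) = cong (fn f) (subTs-renTs σ ρ ts)

  subTs-renTs : ∀ {n} σ ρ (ts : Vec Term n) → subTs σ (renTs ρ ts) ≡ subTs (σ ∘ ρ) ts
  subTs-renTs σ ρ []       = refl
  subTs-renTs σ ρ (t ∷ ts) = cong₂ _∷_ (subT-renT σ ρ t) (subTs-renTs σ ρ ts)

mutual
  renT-subT : ∀ ρ σ t → renT ρ (subT σ t) ≡ subT (renT ρ ∘ σ) t
  renT-subT ρ σ (var i)   = refl
  renT-subT ρ σ (fn f ts) = cong (fn f) (renTs-subTs ρ σ ts)

  renTs-subTs : ∀ {n} ρ σ (ts : Vec Term n) → renTs ρ (subTs σ ts) ≡ subTs (renT ρ ∘ σ) ts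
  renTs-subTs ρ σ []       = refl
  renTs-subTs ρ σ (t ∷ ts) = cong₂ _∷_ (renT-subT ρ σ t) (renTs-subTs ρ σ ts)

mutual
  subT-var : ∀ t → subT var t ≡ t
  subT-var (var i)   = refl
  subT-var (fn f ts) = cong (fn f) (subTs-var ts)

  subTs-var : ∀ {n} (ts : Vec Term n) → subTs var ts ≡ ts
  subTs-var []       = refl
  subTs-var (t ∷ ts) = cong₂ _∷_ (subT-var t) (subTs-var ts)

mutual
  renT≗subT : ∀ ρ → renT ρ ≗ subT (var ∘ ρ)
  renT≗subT ρ (var i)   = refl
  renT≗subT ρ (fn f ts) = cong (fn f) (renTs≗subTs ρ ts)

  renTs≗subTs : ∀ {n} ρ (ts : Vec Term n) → renTs ρ ts ≡ subTs (var ∘ ρ) ts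
  renTs≗subTs ρ []       = refl
  renTs≗subTs ρ (t ∷ ts) = cong₂ _∷_ (renT≗subT ρ t) (renTs≗subTs ρ ts)

liftR-cong : ∀ {ρ ρ′} → ρ ≗ ρ′ → liftR ρ ≗ liftR ρ′
liftR-cong h zero    = refl
liftR-cong h (suc i) = cong suc (h i)

liftS-cong : ∀ {σ σ′} → σ ≗ σ′ → liftS σ ≗ liftS σ′
liftS-cong h zero    = refl
liftS-cong h (suc i) = cong (renT suc) (h i)

liftR-∘ : ∀ ρ ρ′ → liftR ρ ∘ liftR ρ′ ≗ liftR (ρ ∘ ρ′)
liftR-∘ ρ ρ′ zero    = refl
liftR-∘ ρ ρ′ (suc i) = refl

liftS-liftR : ∀ σ ρ → liftS σ ∘ liftR ρ ≗ liftS (σ ∘ ρ)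
liftS-liftR σ ρ zero    = refl
liftS-liftR σ ρ (suc i) = refl

liftS-var : liftS var ≗ var
liftS-var zero    = refl
liftS-var (suc i) = refl

liftR≗liftS : ∀ ρ → var ∘ liftR ρ ≗ liftS (var ∘ ρ)
liftR≗liftS ρ zero    = refl
liftR≗liftS ρ (suc i) = refl

renF-cong : ∀ {ρ ρ′} → ρ ≗ ρ′ → renF ρ ≗ renF ρ′
renF-cong h (t ≐ s)  = cong₂ _≐_ (renT-cong h t) (renT-cong h s)
renF-cong h ⊥'       = refl
renF-cong h (A ∧' B) = cong₂ _∧'_ (renF-cong h A) (renF-cong h B)
renF-cong h (A ∨' B) = cong₂ _∨'_ (renF-cong h A) (renF-cong h B)
renF-cong h (A ⇒ B)  = cong₂ _⇒_ (renF-cong h A) (renF-cong h B)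
renF-cong h (∀' A)   = cong ∀' (renF-cong (liftR-cong h) A)
renF-cong h (∃' A)   = cong ∃' (renF-cong (liftR-cong h) A)

subF-cong : ∀ {σ σ′} → σ ≗ σ′ → subF σ ≗ subF σ′
subF-cong h (t ≐ s)  = cong₂ _≐_ (subT-cong h t) (subT-cong h s)
subF-cong h ⊥'       = refl
subF-cong h (A ∧' B) = cong₂ _∧'_ (subF-cong h A) (subF-cong h B)
subF-cong h (A ∨' B) = cong₂ _∨'_ (subF-cong h A) (subF-cong h B)
subF-cong h (A ⇒ B)  = cong₂ _⇒_ (subF-cong h A) (subF-cong h B)
subF-cong h (∀' A)   = cong ∀' (subF-cong (liftS-cong h) A)
subF-cong h (∃' A)   = cong ∃' (subF-cong (liftS-cong h) A)

renF-∘ : ∀ ρ ρ′ A → renF ρ (renF ρ′ A) ≡ renF (ρ ∘ ρ′) A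
renF-∘ ρ ρ′ (t ≐ s)  = cong₂ _≐_ (renT-∘ ρ ρ′ t) (renT-∘ ρ ρ′ s)
renF-∘ ρ ρ′ ⊥'       = refl
renF-∘ ρ ρ′ (A ∧' B) = cong₂ _∧'_ (renF-∘ ρ ρ′ A) (renF-∘ ρ ρ′ B)
renF-∘ ρ ρ′ (A ∨' B) = cong₂ _∨'_ (renF-∘ ρ ρ′ A) (renF-∘ ρ ρ′ B)
renF-∘ ρ ρ′ (A ⇒ B)  = cong₂ _⇒_ (renF-∘ ρ ρ′ A) (renF-∘ ρ ρ′ B)
renF-∘ ρ ρ′ (∀' A)   = cong ∀' (trans (renF-∘ (liftR ρ) (liftR ρ′) A) (renF-cong (liftR-∘ ρ ρ′) A))
renF-∘ ρ ρ′ (∃' A)   = cong ∃' (trans (renF-∘ (liftR ρ) (liftR ρ′) A) (renF-cong (liftR-∘ ρ ρ′) A))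

subF-renF : ∀ σ ρ A → subF σ (renF ρ A) ≡ subF (σ ∘ ρ) A
subF-renF σ ρ (t ≐ s)  = cong₂ _≐_ (subT-renT σ ρ t) (subT-renT σ ρ s)
subF-renF σ ρ ⊥'       = refl
subF-renF σ ρ (A ∧' B) = cong₂ _∧'_ (subF-renF σ ρ A) (subF-renF σ ρ B)
subF-renF σ ρ (A ∨' B) = cong₂ _∨'_ (subF-renF σ ρ A) (subF-renF σ ρ B)
subF-renF σ ρ (A ⇒ B)  = cong₂ _⇒_ (subF-renF σ ρ A) (subF-renF σ ρ B)
subF-renF σ ρ (∀' A)   = cong ∀' (trans (subF-renF (liftS σ) (liftR ρ) A) (subF-cong (liftS-liftR σ ρ) A))
subF-renF σ ρ (∃' A)   = cong ∃' (trans (subF-renF (liftS σ) (liftR ρ) A) (subF-cong (liftS-liftR σ ρ) A))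

renT-liftR-liftS : ∀ ρ σ → renT (liftR ρ) ∘ liftS σ ≗ liftS (renT ρ ∘ σ)
renT-liftR-liftS ρ σ zero    = refl
renT-liftR-liftS ρ σ (suc i) = trans (renT-∘ (liftR ρ) suc (σ i)) (sym (renT-∘ suc ρ (σ i)))

renF-subF : ∀ ρ σ A → renF ρ (subF σ A) ≡ subF (renT ρ ∘ σ) A
renF-subF ρ σ (t ≐ s)  = cong₂ _≐_ (renT-subT ρ σ t) (renT-subT ρ σ s)
renF-subF ρ σ ⊥'       = refl
renF-subF ρ σ (A ∧' B) = cong₂ _∧'_ (renF-subF ρ σ A) (renF-subF ρ σ B)
renF-subF ρ σ (A ∨' B) = cong₂ _∨'_ (renF-subF ρ σ A) (renF-subF ρ σ B)
renF-subF ρ σ (A ⇒ B)  = cong₂ _⇒_ (renF-subF ρ σ A) (renF-subF ρ σ B)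
renF-subF ρ σ (∀' A)   = cong ∀' (trans (renF-subF (liftR ρ) (liftS σ) A) (subF-cong (renT-liftR-liftS ρ σ) A))
renF-subF ρ σ (∃' A)   = cong ∃' (trans (renF-subF (liftR ρ) (liftS σ) A) (subF-cong (renT-liftR-liftS ρ σ) A))

subF-var : ∀ A → subF var A ≡ A
subF-var (t ≐ s)  = cong₂ _≐_ (subT-var t) (subT-var s)
subF-var ⊥'       = refl
subF-var (A ∧' B) = cong₂ _∧'_ (subF-var A) (subF-var B)
subF-var (A ∨' B) = cong₂ _∨'_ (subF-var A) (subF-var B)
subF-var (A ⇒ B)  = cong₂ _⇒_ (subF-var A) (subF-var B)
subF-var (∀' A)   = cong ∀' (trans (subF-cong liftS-var A) (subF-var A))
subF-var (∃' A)   = cong ∃' (trans (subF-cong liftS-var A) (subF-var A))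

renF≗subF : ∀ ρ → renF ρ ≗ subF (var ∘ ρ)
renF≗subF ρ (t ≐ s)  = cong₂ _≐_ (renT≗subT ρ t) (renT≗subT ρ s)
renF≗subF ρ ⊥'       = refl
renF≗subF ρ (A ∧' B) = cong₂ _∧'_ (renF≗subF ρ A) (renF≗subF ρ B)
renF≗subF ρ (A ∨' B) = cong₂ _∨'_ (renF≗subF ρ A) (renF≗subF ρ B)
renF≗subF ρ (A ⇒ B)  = cong₂ _⇒_ (renF≗subF ρ A) (renF≗subF ρ B)
renF≗subF ρ (∀' A)   = cong ∀' (trans (renF≗subF (liftR ρ) A) (subF-cong (liftR≗liftS ρ) A))
renF≗subF ρ (∃' A)   = cong ∃' (trans (renF≗subF (liftR ρ) A) (subF-cong (liftR≗liftS ρ) A))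

liftR-suc-[var0] : ∀ A → renF (liftR suc) A [ var 0 ] ≡ A
liftR-suc-[var0] A = trans (subF-renF (inst (var 0)) (liftR suc) A)
                           (trans (subF-cong (λ { zero → refl ; (suc i) → refl }) A) (subF-var A))

↑-[] : ∀ C t → ↑ C [ t ] ≡ C
↑-[] C t = trans (subF-renF (inst t) suc C) (subF-var C)

subF-succ0-↑ : ∀ C → subF succ0 (↑ C) ≡ ↑ C
subF-succ0-↑ C = trans (subF-renF succ0 suc C) (sym (renF≗subF suc C))

subF-liftS-↑ : ∀ σ C → subF (liftS σ) (↑ C) ≡ ↑ (subF σ C)
subF-liftS-↑ σ C = trans (subF-renF (liftS σ) suc C) (sym (renF-subF suc σ C))

renF-liftR-↑ : ∀ ρ C → renF (liftR ρ) (↑ C) ≡ ↑ (renF ρ C)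
renF-liftR-↑ ρ C = trans (renF-∘ (liftR ρ) suc C) (sym (renF-∘ suc ρ C))

renF-[] : ∀ ρ A t → renF ρ (A [ t ]) ≡ renF (liftR ρ) A [ renT ρ t ]
renF-[] ρ A t = trans (renF-subF ρ (inst t) A)
  (trans (subF-cong (λ { zero → refl ; (suc i) → refl }) A) (sym (subF-renF (inst (renT ρ t)) (liftR ρ) A)))

renF-liftR-succ0 : ∀ ρ A → renF (liftR ρ) (subF succ0 A) ≡ subF succ0 (renF (liftR ρ) A)
renF-liftR-succ0 ρ A = trans (renF-subF (liftR ρ) succ0 A)
  (trans (subF-cong (λ { zero → refl ; (suc i) → refl }) A) (sym (subF-renF succ0 (liftR ρ) A)))

_⟶⟨_⟩_ : Form → (Form → Set) → Form → Set
A ⟶⟨ T ⟩ B = ∀ {Γ} → Γ ⊢[ T ] A ⇒ B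

module _ {T : Form → Set} where

  weaken : ∀ {Γ Δ A} → Γ ⊆ Δ → Γ ⊢[ T ] A → Δ ⊢[ T ] A
  weaken s (hyp x)             = hyp (s x)
  weaken s (ax x)              = ax x
  weaken s (∧I d e)            = ∧I (weaken s d) (weaken s e)
  weaken s (∧E₁ d)             = ∧E₁ (weaken s d)
  weaken s (∧E₂ d)             = ∧E₂ (weaken s d)
  weaken s (∨I₁ d)             = ∨I₁ (weaken s d)
  weaken s (∨I₂ d)             = ∨I₂ (weaken s d)
  weaken s (∨E d e f)          = ∨E (weaken s d) (weaken (∷⁺ʳ _ s) e) (weaken (∷⁺ʳ _ s) f)
  weaken s (⇒I d)              = ⇒I (weaken (∷⁺ʳ _ s) d)
  weaken s (⇒E d e)            = ⇒E (weaken s d) (weaken s e)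
  weaken s (⊥E d)              = ⊥E (weaken s d)
  weaken s (∀I d)              = ∀I (weaken (⊆.map⁺ ↑ s) d)
  weaken s (∀E t d)            = ∀E t (weaken s d)
  weaken s (∃I t d)            = ∃I t (weaken s d)
  weaken s (∃E d e)            = ∃E (weaken s d) (weaken (∷⁺ʳ _ (⊆.map⁺ ↑ s)) e)
  weaken s (refl≐ t)           = refl≐ t
  weaken s (subst≐ φ d e)      = subst≐ φ (weaken s d) (weaken s e)
  weaken s (S≠0 t)             = S≠0 t
  weaken s (S-inj t u)         = S-inj t u
  weaken s (def-Pj i ts)       = def-Pj i ts
  weaken s (def-Cmp f gs ts)   = def-Cmp f gs ts
  weaken s (def-Rec0 f g ts)   = def-Rec0 f g ts
  weaken s (def-RecS f g t ts) = def-RecS f g t ts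
  weaken s (ind φ)             = ind φ

  wk₁ : ∀ {Γ A B} → Γ ⊢[ T ] A → (B ∷ Γ) ⊢[ T ] A
  wk₁ = weaken there

  wk₂ : ∀ {Γ A B C} → Γ ⊢[ T ] A → (B ∷ C ∷ Γ) ⊢[ T ] A
  wk₂ = weaken (there ∘ there)

  #0 : ∀ {Γ A} → (A ∷ Γ) ⊢[ T ] A
  #0 = hyp (here refl)

  #1 : ∀ {Γ A B} → (B ∷ A ∷ Γ) ⊢[ T ] A
  #1 = hyp (there (here refl))

  #2 : ∀ {Γ A B C} → (C ∷ B ∷ A ∷ Γ) ⊢[ T ] A
  #2 = hyp (there (there (here refl)))

  #3 : ∀ {Γ A B C D} → (D ∷ C ∷ B ∷ A ∷ Γ) ⊢[ T ] A
  #3 = hyp (there (there (there (here refl))))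

  cast : ∀ {Γ A B} → A ≡ B → Γ ⊢[ T ] A → Γ ⊢[ T ] B
  cast refl d = d

  -- Under a binder a hypothesis ∀x A appears as ↑ (∀' A); instantiate it at the bound variable.
  ∀E-var0 : ∀ {Γ A} → Γ ⊢[ T ] ↑ (∀' A) → Γ ⊢[ T ] A
  ∀E-var0 {A = A} d = cast (liftR-suc-[var0] A) (∀E (var 0) d)

  ∃I-var0 : ∀ {Γ A} → Γ ⊢[ T ] A → Γ ⊢[ T ] ↑ (∃' A)
  ∃I-var0 {A = A} d = ∃I (var 0) (cast (sym (liftR-suc-[var0] A)) d)

  ⟶-refl : ∀ {A} → A ⟶⟨ T ⟩ A
  ⟶-refl = ⇒I #0

  ⟶-trans : ∀ {A B C} → A ⟶⟨ T ⟩ B → B ⟶⟨ T ⟩ C → A ⟶⟨ T ⟩ C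
  ⟶-trans i j = ⇒I (⇒E j (⇒E i #0))

  ∧-mono : ∀ {A A′ B B′} → A ⟶⟨ T ⟩ A′ → B ⟶⟨ T ⟩ B′ → (A ∧' B) ⟶⟨ T ⟩ (A′ ∧' B′)
  ∧-mono i j = ⇒I (∧I (⇒E i (∧E₁ #0)) (⇒E j (∧E₂ #0)))

  ∨-mono : ∀ {A A′ B B′} → A ⟶⟨ T ⟩ A′ → B ⟶⟨ T ⟩ B′ → (A ∨' B) ⟶⟨ T ⟩ (A′ ∨' B′)
  ∨-mono i j = ⇒I (∨E #0 (∨I₁ (⇒E i #0)) (∨I₂ (⇒E j #0)))

  ⇒-mono : ∀ {A A′ B B′} → A′ ⟶⟨ T ⟩ A → B ⟶⟨ T ⟩ B′ → (A ⇒ B) ⟶⟨ T ⟩ (A′ ⇒ B′)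
  ⇒-mono i j = ⇒I (⇒I (⇒E j (⇒E #1 (⇒E i #0))))

  ∀-mono : ∀ {A B} → A ⟶⟨ T ⟩ B → ∀' A ⟶⟨ T ⟩ ∀' B
  ∀-mono i = ⇒I (∀I (⇒E i (∀E-var0 #0)))

  ∃-mono : ∀ {A B} → A ⟶⟨ T ⟩ B → ∃' A ⟶⟨ T ⟩ ∃' B
  ∃-mono i = ⇒I (∃E #0 (∃I-var0 (⇒E i #0)))

  ⇒-∧-intro : ∀ {Γ ψ A B} → Γ ⊢[ T ] ψ ⇒ A → Γ ⊢[ T ] ψ ⇒ B → Γ ⊢[ T ] ψ ⇒ A ∧' B
  ⇒-∧-intro d e = ⇒I (∧I (⇒E (wk₁ d) #0) (⇒E (wk₁ e) #0))

  ⇒-∧-elim₁ : ∀ {Γ ψ A B} → Γ ⊢[ T ] ψ ⇒ A ∧' B → Γ ⊢[ T ] ψ ⇒ A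
  ⇒-∧-elim₁ d = ⇒I (∧E₁ (⇒E (wk₁ d) #0))

  ⇒-∧-elim₂ : ∀ {Γ ψ A B} → Γ ⊢[ T ] ψ ⇒ A ∧' B → Γ ⊢[ T ] ψ ⇒ B
  ⇒-∧-elim₂ d = ⇒I (∧E₂ (⇒E (wk₁ d) #0))

  ⇒-∀-intro : ∀ {Γ ψ A} → List.map ↑ Γ ⊢[ T ] ↑ ψ ⇒ A → Γ ⊢[ T ] ψ ⇒ ∀' A
  ⇒-∀-intro d = ⇒I (∀I (⇒E (wk₁ d) #0))

  ⇒-∀-elim : ∀ {Γ ψ A} → Γ ⊢[ T ] ψ ⇒ ↑ (∀' A) → Γ ⊢[ T ] ψ ⇒ A
  ⇒-∀-elim d = ⇒I (∀E-var0 (⇒E (wk₁ d) #0))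

⟦_⟧[_] : Form → Form → Form
⟦ t ≐ s ⟧[ D ]  = ((t ≐ s) ⇒ D) ⇒ D
⟦ ⊥' ⟧[ D ]     = D
⟦ A ∧' B ⟧[ D ] = ⟦ A ⟧[ D ] ∧' ⟦ B ⟧[ D ]
⟦ A ∨' B ⟧[ D ] = ((⟦ A ⟧[ D ] ⇒ D) ∧' (⟦ B ⟧[ D ] ⇒ D)) ⇒ D
⟦ A ⇒ B ⟧[ D ]  = ⟦ A ⟧[ D ] ⇒ ⟦ B ⟧[ D ]
⟦ ∀' A ⟧[ D ]   = ∀' ⟦ A ⟧[ ↑ D ]
⟦ ∃' A ⟧[ D ]   = ∀' (⟦ A ⟧[ ↑ D ] ⇒ ↑ D) ⇒ D

subF-⟦⟧ : ∀ σ D A → subF σ ⟦ A ⟧[ D ] ≡ ⟦ subF σ A ⟧[ subF σ D ]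
subF-⟦⟧ σ D (t ≐ s)  = refl
subF-⟦⟧ σ D ⊥'       = refl
subF-⟦⟧ σ D (A ∧' B) = cong₂ _∧'_ (subF-⟦⟧ σ D A) (subF-⟦⟧ σ D B)
subF-⟦⟧ σ D (A ∨' B) =
  cong₂ (λ a b → ((a ⇒ subF σ D) ∧' (b ⇒ subF σ D)) ⇒ subF σ D) (subF-⟦⟧ σ D A) (subF-⟦⟧ σ D B)
subF-⟦⟧ σ D (A ⇒ B)  = cong₂ _⇒_ (subF-⟦⟧ σ D A) (subF-⟦⟧ σ D B)
subF-⟦⟧ σ D (∀' A)   = cong ∀' (trans (subF-⟦⟧ (liftS σ) (↑ D) A) (cong ⟦ subF (liftS σ) A ⟧[_] (subF-liftS-↑ σ D)))
subF-⟦⟧ σ D (∃' A)   = cong (λ a → ∀' a ⇒ subF σ D)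
  (trans (cong (_⇒ subF (liftS σ) (↑ D)) (subF-⟦⟧ (liftS σ) (↑ D) A))
         (cong (λ d → ⟦ subF (liftS σ) A ⟧[ d ] ⇒ d) (subF-liftS-↑ σ D)))

renF-⟦⟧ : ∀ ρ D A → renF ρ ⟦ A ⟧[ D ] ≡ ⟦ renF ρ A ⟧[ renF ρ D ]
renF-⟦⟧ ρ D (t ≐ s)  = refl
renF-⟦⟧ ρ D ⊥'       = refl
renF-⟦⟧ ρ D (A ∧' B) = cong₂ _∧'_ (renF-⟦⟧ ρ D A) (renF-⟦⟧ ρ D B)
renF-⟦⟧ ρ D (A ∨' B) =
  cong₂ (λ a b → ((a ⇒ renF ρ D) ∧' (b ⇒ renF ρ D)) ⇒ renF ρ D) (renF-⟦⟧ ρ D A) (renF-⟦⟧ ρ D B)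
renF-⟦⟧ ρ D (A ⇒ B)  = cong₂ _⇒_ (renF-⟦⟧ ρ D A) (renF-⟦⟧ ρ D B)
renF-⟦⟧ ρ D (∀' A)   = cong ∀' (trans (renF-⟦⟧ (liftR ρ) (↑ D) A) (cong ⟦ renF (liftR ρ) A ⟧[_] (renF-liftR-↑ ρ D)))
renF-⟦⟧ ρ D (∃' A)   = cong (λ a → ∀' a ⇒ renF ρ D)
  (trans (cong (_⇒ renF (liftR ρ) (↑ D)) (renF-⟦⟧ (liftR ρ) (↑ D) A))
         (cong (λ d → ⟦ renF (liftR ρ) A ⟧[ d ] ⇒ d) (renF-liftR-↑ ρ D)))

⟦⟧-[] : ∀ D A t → ⟦ A ⟧[ ↑ D ] [ t ] ≡ ⟦ A [ t ] ⟧[ D ]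
⟦⟧-[] D A t = trans (subF-⟦⟧ (inst t) (↑ D) A) (cong ⟦ A [ t ] ⟧[_] (↑-[] D t))

⟦⟧-succ0 : ∀ D A → subF succ0 ⟦ A ⟧[ ↑ D ] ≡ ⟦ subF succ0 A ⟧[ ↑ D ]
⟦⟧-succ0 D A = trans (subF-⟦⟧ succ0 (↑ D) A) (cong ⟦ subF succ0 A ⟧[_] (subF-succ0-↑ D))

map-↑-⟦⟧ : ∀ D Γ → List.map ↑ (List.map ⟦_⟧[ D ] Γ) ≡ List.map ⟦_⟧[ ↑ D ] (List.map ↑ Γ)
map-↑-⟦⟧ D []      = refl
map-↑-⟦⟧ D (A ∷ Γ) = cong₂ _∷_ (renF-⟦⟧ suc D A) (map-↑-⟦⟧ D Γ)

module _ {T : Form → Set} where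

  D⟶⟦⟧ : ∀ {D} A → D ⟶⟨ T ⟩ ⟦ A ⟧[ D ]
  D⟶⟦⟧ (t ≐ s)  = ⇒I (⇒I #1)
  D⟶⟦⟧ ⊥'       = ⇒I #0
  D⟶⟦⟧ (A ∧' B) = ⇒I (∧I (⇒E (D⟶⟦⟧ A) #0) (⇒E (D⟶⟦⟧ B) #0))
  D⟶⟦⟧ (A ∨' B) = ⇒I (⇒I #1)
  D⟶⟦⟧ (A ⇒ B)  = ⇒I (⇒I (⇒E (D⟶⟦⟧ B) #1))
  D⟶⟦⟧ (∀' A)   = ⇒I (∀I (⇒E (D⟶⟦⟧ A) #0))
  D⟶⟦⟧ (∃' A)   = ⇒I (⇒I #1)

  triple-D-elim : ∀ {A D} → (((A ⇒ D) ⇒ D) ⇒ D) ⟶⟨ T ⟩ (A ⇒ D)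
  triple-D-elim = ⇒I (⇒I (⇒E #1 (⇒I (⇒E #0 #1))))

  ⟦⟧-stable : ∀ {D} A → ((⟦ A ⟧[ D ] ⇒ D) ⇒ D) ⟶⟨ T ⟩ ⟦ A ⟧[ D ]
  ⟦⟧-stable (t ≐ s)  = triple-D-elim
  ⟦⟧-stable ⊥'       = ⇒I (⇒E #0 (⇒I #0))
  ⟦⟧-stable (A ∧' B) = ⇒I (∧I (⇒E (⟦⟧-stable A) (⇒I (⇒E #1 (⇒I (⇒E #1 (∧E₁ #0))))))
                              (⇒E (⟦⟧-stable B) (⇒I (⇒E #1 (⇒I (⇒E #1 (∧E₂ #0)))))))
  ⟦⟧-stable (A ∨' B) = triple-D-elim
  ⟦⟧-stable (A ⇒ B)  = ⇒I (⇒I (⇒E (⟦⟧-stable B) (⇒I (⇒E #2 (⇒I (⇒E #1 (⇒E #0 #2)))))))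
  ⟦⟧-stable (∀' A)   = ⇒I (∀I (⇒E (⟦⟧-stable A) (⇒I (⇒E #1 (⇒I (⇒E #1 (∀E-var0 #0)))))))
  ⟦⟧-stable (∃' A)   = triple-D-elim

  ⟦⟧-sound : ∀ {X : Form → Set} → (∀ {θ Γ} D → X θ → Γ ⊢[ T ] ⟦ θ ⟧[ D ]) →
             ∀ {Γ A} → Γ ⊢[ PAX X ] A → ∀ D → List.map ⟦_⟧[ D ] Γ ⊢[ T ] ⟦ A ⟧[ D ]
  ⟦⟧-sound axX (hyp x) D          = hyp (∈-map⁺ ⟦_⟧[ D ] x)
  ⟦⟧-sound axX (ax (fromX x)) D   = axX D x
  ⟦⟧-sound axX (ax (lem φ)) D     = ⇒I (⇒E (∧E₂ #0) (∧E₁ #0))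
  ⟦⟧-sound axX (∧I d e) D         = ∧I (⟦⟧-sound axX d D) (⟦⟧-sound axX e D)
  ⟦⟧-sound axX (∧E₁ d) D          = ∧E₁ (⟦⟧-sound axX d D)
  ⟦⟧-sound axX (∧E₂ d) D          = ∧E₂ (⟦⟧-sound axX d D)
  ⟦⟧-sound axX (∨I₁ d) D          = ⇒I (⇒E (∧E₁ #0) (wk₁ (⟦⟧-sound axX d D)))
  ⟦⟧-sound axX (∨I₂ d) D          = ⇒I (⇒E (∧E₂ #0) (wk₁ (⟦⟧-sound axX d D)))
  ⟦⟧-sound axX (∨E {χ = χ} d e f) D = ⇒E (⟦⟧-stable χ) (⇒I (⇒E (wk₁ (⟦⟧-sound axX d D))
    (∧I (⇒I (⇒E #1 (weaken (∷⁺ʳ _ there) (⟦⟧-sound axX e D))))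
        (⇒I (⇒E #1 (weaken (∷⁺ʳ _ there) (⟦⟧-sound axX f D)))))))
  ⟦⟧-sound axX (⇒I d) D           = ⇒I (⟦⟧-sound axX d D)
  ⟦⟧-sound axX (⇒E d e) D         = ⇒E (⟦⟧-sound axX d D) (⟦⟧-sound axX e D)
  ⟦⟧-sound axX (⊥E {φ = φ} d) D   = ⇒E (D⟶⟦⟧ φ) (⟦⟧-sound axX d D)
  ⟦⟧-sound axX {Γ} (∀I d) D       = ∀I (subst (_⊢[ T ] _) (sym (map-↑-⟦⟧ D Γ)) (⟦⟧-sound axX d (↑ D)))
  ⟦⟧-sound axX (∀E {φ = φ} t d) D = cast (⟦⟧-[] D φ t) (∀E t (⟦⟧-sound axX d D))
  ⟦⟧-sound axX (∃I {φ = φ} t d) D =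
    ⇒I (⇒E (cast (cong₂ _⇒_ (⟦⟧-[] D φ t) (↑-[] D t)) (∀E t #0)) (wk₁ (⟦⟧-sound axX d D)))
  ⟦⟧-sound axX {Γ} (∃E {φ = φ} {χ = χ} d e) D = ⇒E (⟦⟧-stable χ) (⇒I (⇒E (wk₁ (⟦⟧-sound axX d D))
    (∀I (⇒I (⇒E #1 (weaken (∷⁺ʳ _ there) e′))))))
    where
    e′ : (⟦ φ ⟧[ ↑ D ] ∷ List.map ↑ (List.map ⟦_⟧[ D ] Γ)) ⊢[ T ] ↑ ⟦ χ ⟧[ D ]
    e′ = subst₂ (λ Δ B → (⟦ φ ⟧[ ↑ D ] ∷ Δ) ⊢[ T ] B) (sym (map-↑-⟦⟧ D Γ)) (sym (renF-⟦⟧ suc D χ))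
                (⟦⟧-sound axX e (↑ D))
  ⟦⟧-sound axX (refl≐ t) D        = ⇒I (⇒E #0 (refl≐ t))
  ⟦⟧-sound axX (subst≐ φ {t} {s} d e) D = ⇒E (⟦⟧-stable (φ [ s ])) (⇒I (⇒E (wk₁ (⟦⟧-sound axX d D))
    (⇒I (⇒E #1 (cast (⟦⟧-[] D φ s)
      (subst≐ ⟦ φ ⟧[ ↑ D ] #0 (cast (sym (⟦⟧-[] D φ t)) (wk₂ (⟦⟧-sound axX e D)))))))))
  ⟦⟧-sound axX (S≠0 t) D          = ⇒I (⇒E #0 (⇒I (⊥E (⇒E (S≠0 t) #0))))
  ⟦⟧-sound axX (S-inj t s) D      = ⇒I (⇒I (⇒E #1 (⇒I (⇒E #1 (⇒E (S-inj t s) #0)))))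
  ⟦⟧-sound axX (def-Pj i ts) D    = ⇒I (⇒E #0 (def-Pj i ts))
  ⟦⟧-sound axX (def-Cmp f gs ts) D = ⇒I (⇒E #0 (def-Cmp f gs ts))
  ⟦⟧-sound axX (def-Rec0 f g ts) D = ⇒I (⇒E #0 (def-Rec0 f g ts))
  ⟦⟧-sound axX (def-RecS f g t ts) D = ⇒I (⇒E #0 (def-RecS f g t ts))
  ⟦⟧-sound axX (ind φ) D          =
    cast (cong₂ (λ a b → (a ∧' ∀' (⟦ φ ⟧[ ↑ D ] ⇒ b)) ⇒ ∀' ⟦ φ ⟧[ ↑ D ]) (⟦⟧-[] D φ zero') (⟦⟧-succ0 D φ))
         (ind ⟦ φ ⟧[ ↑ D ])

lookup-renTs : ∀ {n} ρ (ts : Vec Term n) i → lookup (renTs ρ ts) i ≡ renT ρ (lookup ts i)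
lookup-renTs ρ (t ∷ ts) Fin.zero    = refl
lookup-renTs ρ (t ∷ ts) (Fin.suc i) = lookup-renTs ρ ts i

renTs-map-fn : ∀ {m n} ρ (gs : Vec (PR n) m) (ts : Vec Term n) →
               renTs ρ (Vec.map (λ g → fn g ts) gs) ≡ Vec.map (λ g → fn g (renTs ρ ts)) gs
renTs-map-fn ρ []       ts = refl
renTs-map-fn ρ (g ∷ gs) ts = cong (fn g (renTs ρ ts) ∷_) (renTs-map-fn ρ gs ts)

map-↑-renF : ∀ ρ Γ → List.map (renF (liftR ρ)) (List.map ↑ Γ) ≡ List.map ↑ (List.map (renF ρ) Γ)
map-↑-renF ρ []      = refl
map-↑-renF ρ (A ∷ Γ) = cong₂ _∷_ (renF-liftR-↑ ρ A) (map-↑-renF ρ Γ)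

module _ {T : Form → Set} (T-renF : ∀ {θ} ρ → T θ → T (renF ρ θ)) where

  ⊢-renF : ∀ {Γ A} → Γ ⊢[ T ] A → ∀ ρ → List.map (renF ρ) Γ ⊢[ T ] renF ρ A
  ⊢-renF (hyp x) ρ          = hyp (∈-map⁺ (renF ρ) x)
  ⊢-renF (ax x) ρ           = ax (T-renF ρ x)
  ⊢-renF (∧I d e) ρ         = ∧I (⊢-renF d ρ) (⊢-renF e ρ)
  ⊢-renF (∧E₁ d) ρ          = ∧E₁ (⊢-renF d ρ)
  ⊢-renF (∧E₂ d) ρ          = ∧E₂ (⊢-renF d ρ)
  ⊢-renF (∨I₁ d) ρ          = ∨I₁ (⊢-renF d ρ)
  ⊢-renF (∨I₂ d) ρ          = ∨I₂ (⊢-renF d ρ)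
  ⊢-renF (∨E d e f) ρ       = ∨E (⊢-renF d ρ) (⊢-renF e ρ) (⊢-renF f ρ)
  ⊢-renF (⇒I d) ρ           = ⇒I (⊢-renF d ρ)
  ⊢-renF (⇒E d e) ρ         = ⇒E (⊢-renF d ρ) (⊢-renF e ρ)
  ⊢-renF (⊥E d) ρ           = ⊥E (⊢-renF d ρ)
  ⊢-renF {Γ} (∀I d) ρ       = ∀I (subst (_⊢[ T ] _) (map-↑-renF ρ Γ) (⊢-renF d (liftR ρ)))
  ⊢-renF (∀E {φ = φ} t d) ρ = cast (sym (renF-[] ρ φ t)) (∀E (renT ρ t) (⊢-renF d ρ))
  ⊢-renF (∃I {φ = φ} t d) ρ = ∃I (renT ρ t) (cast (renF-[] ρ φ t) (⊢-renF d ρ))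
  ⊢-renF {Γ} (∃E {φ = φ} {χ = χ} d e) ρ = ∃E (⊢-renF d ρ)
    (subst₂ (λ Δ B → (renF (liftR ρ) φ ∷ Δ) ⊢[ T ] B) (map-↑-renF ρ Γ) (renF-liftR-↑ ρ χ) (⊢-renF e (liftR ρ)))
  ⊢-renF (refl≐ t) ρ        = refl≐ (renT ρ t)
  ⊢-renF (subst≐ φ {t} {s} d e) ρ =
    cast (sym (renF-[] ρ φ s)) (subst≐ (renF (liftR ρ) φ) (⊢-renF d ρ) (cast (renF-[] ρ φ t) (⊢-renF e ρ)))
  ⊢-renF (S≠0 t) ρ          = S≠0 (renT ρ t)
  ⊢-renF (S-inj t s) ρ      = S-inj (renT ρ t) (renT ρ s)
  ⊢-renF (def-Pj i ts) ρ    =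
    cast (cong (fn (Pj i) (renTs ρ ts) ≐_) (lookup-renTs ρ ts i)) (def-Pj i (renTs ρ ts))
  ⊢-renF (def-Cmp f gs ts) ρ =
    cast (cong (λ us → fn (Cmp f gs) (renTs ρ ts) ≐ fn f us) (sym (renTs-map-fn ρ gs ts)))
         (def-Cmp f gs (renTs ρ ts))
  ⊢-renF (def-Rec0 f g ts) ρ   = def-Rec0 f g (renTs ρ ts)
  ⊢-renF (def-RecS f g t ts) ρ = def-RecS f g (renT ρ t) (renTs ρ ts)
  ⊢-renF (ind φ) ρ          =
    cast (cong₂ (λ a b → (a ∧' ∀' (renF (liftR ρ) φ ⇒ b)) ⇒ ∀' (renF (liftR ρ) φ))
                (sym (renF-[] ρ φ zero')) (sym (renF-liftR-succ0 ρ φ)))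
         (ind (renF (liftR ρ) φ))

FixesBelow : ℕ → (ℕ → ℕ) → Set
FixesBelow n ρ = ∀ i → i < n → ρ i ≡ i

liftR-FixesBelow : ∀ {n ρ} → FixesBelow n ρ → FixesBelow (suc n) (liftR ρ)
liftR-FixesBelow h zero    _       = refl
liftR-FixesBelow h (suc i) (s≤s p) = cong suc (h i p)

mutual
  renT-ScopedT : ∀ {n ρ t} → ScopedT n t → FixesBelow n ρ → renT ρ t ≡ t
  renT-ScopedT (var {i} p) h = cong var (h i p)
  renT-ScopedT (fn s) h      = cong (fn _) (renTs-ScopedTs s h)

  renTs-ScopedTs : ∀ {n ρ m} {ts : Vec Term m} → ScopedTs n ts → FixesBelow n ρ → renTs ρ ts ≡ ts
  renTs-ScopedTs [] h       = refl
  renTs-ScopedTs (s ∷ ss) h = cong₂ _∷_ (renT-ScopedT s h) (renTs-ScopedTs ss h)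

renF-Scoped : ∀ {n ρ A} → Scoped n A → FixesBelow n ρ → renF ρ A ≡ A
renF-Scoped (eq s s′) h = cong₂ _≐_ (renT-ScopedT s h) (renT-ScopedT s′ h)
renF-Scoped bot h       = refl
renF-Scoped (and a b) h = cong₂ _∧'_ (renF-Scoped a h) (renF-Scoped b h)
renF-Scoped (or a b) h  = cong₂ _∨'_ (renF-Scoped a h) (renF-Scoped b h)
renF-Scoped (imp a b) h = cong₂ _⇒_ (renF-Scoped a h) (renF-Scoped b h)
renF-Scoped (all a) h   = cong ∀' (renF-Scoped a (liftR-FixesBelow h))
renF-Scoped (ex a) h    = cong ∃' (renF-Scoped a (liftR-FixesBelow h))

renF-Sentence : ∀ {A} ρ → Sentence A → renF ρ A ≡ A
renF-Sentence ρ s = renF-Scoped s (λ _ ())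

PAX-renF : ∀ {X : Form → Set} → (∀ θ → X θ → Sentence θ) → ∀ {θ} ρ → PAX X θ → PAX X (renF ρ θ)
PAX-renF {X} X-closed ρ (fromX {θ} x) = fromX (subst X (sym (renF-Sentence ρ (X-closed θ x))) x)
PAX-renF {X} X-closed ρ (lem φ)       = lem (renF ρ φ)

isQF-renF : ∀ ρ A → isQF (renF ρ A) ≡ isQF A
isQF-renF ρ (t ≐ s)  = refl
isQF-renF ρ ⊥'       = refl
isQF-renF ρ (A ∧' B) = cong₂ _∧_ (isQF-renF ρ A) (isQF-renF ρ B)
isQF-renF ρ (A ∨' B) = cong₂ _∧_ (isQF-renF ρ A) (isQF-renF ρ B)
isQF-renF ρ (A ⇒ B)  = cong₂ _∧_ (isQF-renF ρ A) (isQF-renF ρ B)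
isQF-renF ρ (∀' A)   = refl
isQF-renF ρ (∃' A)   = refl

Alt-renF : ∀ ρ A → Alt (renF ρ A) ≡ Alt A
Alt-renF ρ (t ≐ s)  = refl
Alt-renF ρ ⊥'       = refl
Alt-renF ρ (A ∧' B) rewrite isQF-renF ρ A | isQF-renF ρ B with isQF A ∧ isQF B
... | true  = refl
... | false = cong₂ _++_ (Alt-renF ρ A) (Alt-renF ρ B)
Alt-renF ρ (A ∨' B) rewrite isQF-renF ρ A | isQF-renF ρ B with isQF A ∧ isQF B
... | true  = refl
... | false = cong₂ _++_ (Alt-renF ρ A) (Alt-renF ρ B)
Alt-renF ρ (A ⇒ B)  rewrite isQF-renF ρ A | isQF-renF ρ B with isQF A ∧ isQF B
... | true  = refl
... | false = cong₂ _++_ (cong (List.map (List.map swap)) (Alt-renF ρ A)) (Alt-renF ρ B)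
Alt-renF ρ (∀' A)   = cong (List.map (addQ minus)) (Alt-renF (liftR ρ) A)
Alt-renF ρ (∃' A)   = cong (List.map (addQ plus)) (Alt-renF (liftR ρ) A)

Alt-QF : ∀ A → QF A → Alt A ≡ [] ∷ []
Alt-QF (t ≐ s)  q = refl
Alt-QF ⊥'       q = refl
Alt-QF (B ∧' C) q rewrite q = refl
Alt-QF (B ∨' C) q rewrite q = refl
Alt-QF (B ⇒ C)  q rewrite q = refl

Alt-nonempty : ∀ A → ∃ (_∈ Alt A)
Alt-nonempty (t ≐ s)  = [] , here refl
Alt-nonempty ⊥'       = [] , here refl
Alt-nonempty (B ∧' C) with isQF B ∧ isQF C
... | true  = [] , here refl
... | false = let s , s∈ = Alt-nonempty B in s , ∈-++⁺ˡ s∈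
Alt-nonempty (B ∨' C) with isQF B ∧ isQF C
... | true  = [] , here refl
... | false = let s , s∈ = Alt-nonempty B in s , ∈-++⁺ˡ s∈
Alt-nonempty (B ⇒ C)  with isQF B ∧ isQF C
... | true  = [] , here refl
... | false = let s , s∈ = Alt-nonempty C in s , ∈-++⁺ʳ (List.map (List.map swap) (Alt B)) s∈
Alt-nonempty (∀' B)   = let s , s∈ = Alt-nonempty B in addQ minus s , ∈-map⁺ (addQ minus) s∈
Alt-nonempty (∃' B)   = let s , s∈ = Alt-nonempty B in addQ plus s , ∈-map⁺ (addQ plus) s∈

All-Alt-QF : ∀ {P : List Sym → Set} A → P [] → QF A → All P (Alt A)
All-Alt-QF A P[] q rewrite Alt-QF A q = P[] ∷ []

module _ {P : List Sym → Set} where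

  All-Alt⇒∃ : ∀ A → All P (Alt A) → ∃ P
  All-Alt⇒∃ A al = let s , s∈ = Alt-nonempty A in s , All.lookup al s∈

  module _ (P[] : P []) where

    All-Alt-∧⁻ : ∀ B C → All P (Alt (B ∧' C)) → All P (Alt B) × All P (Alt C)
    All-Alt-∧⁻ B C al with isQF B ∧ isQF C in q
    ... | true  = All-Alt-QF B P[] (∧-conicalˡ _ (isQF C) q) , All-Alt-QF C P[] (∧-conicalʳ (isQF B) _ q)
    ... | false = ++⁻ (Alt B) al

    All-Alt-∨⁻ : ∀ B C → All P (Alt (B ∨' C)) → All P (Alt B) × All P (Alt C)
    All-Alt-∨⁻ B C al with isQF B ∧ isQF C in q
    ... | true  = All-Alt-QF B P[] (∧-conicalˡ _ (isQF C) q) , All-Alt-QF C P[] (∧-conicalʳ (isQF B) _ q)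
    ... | false = ++⁻ (Alt B) al

    All-Alt-⇒⁻ : ∀ B C → All P (Alt (B ⇒ C)) → All (P ∘ List.map swap) (Alt B) × All P (Alt C)
    All-Alt-⇒⁻ B C al with isQF B ∧ isQF C in q
    ... | true  = All-Alt-QF B P[] (∧-conicalˡ _ (isQF C) q) , All-Alt-QF C P[] (∧-conicalʳ (isQF B) _ q)
    ... | false = let aB , aC = ++⁻ (List.map (List.map swap) (Alt B)) al in map⁻ aB , aC

    All-Alt-⇒⁺ : ∀ B C → All (P ∘ List.map swap) (Alt B) → All P (Alt C) → All P (Alt (B ⇒ C))
    All-Alt-⇒⁺ B C aB aC with isQF B ∧ isQF C
    ... | true  = P[] ∷ []
    ... | false = ++⁺ (map⁺ aB) aC

All-≤-foldr-⊔ : ∀ {k} (l : List (List Sym)) → List.foldr _⊔_ 0 (List.map length l) ≤ k →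
                All ((_≤ k) ∘ length) l
All-≤-foldr-⊔ []      p = []
All-≤-foldr-⊔ (s ∷ l) p = ≤-trans (m≤m⊔n (length s) _) p ∷ All-≤-foldr-⊔ l (≤-trans (m≤n⊔m (length s) _) p)

AllPaths≤ : ℕ → Form → Set
AllPaths≤ k A = All ((_≤ k) ∘ length) (Alt A)

F⁺⇒AllPaths≤ : ∀ {k} A → F⁺ k A → AllPaths≤ k A
F⁺⇒AllPaths≤ A = All-≤-foldr-⊔ (Alt A)

length-addQ : ∀ c s → length s ≤ length (addQ c s)
length-addQ plus  []          = z≤n
length-addQ plus  (plus ∷ s)  = ≤-refl
length-addQ plus  (minus ∷ s) = n≤1+n _
length-addQ minus []          = z≤n
length-addQ minus (plus ∷ s)  = n≤1+n _
length-addQ minus (minus ∷ s) = ≤-refl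

1≤length-addQ : ∀ c s → 1 ≤ length (addQ c s)
1≤length-addQ plus  []          = s≤s z≤n
1≤length-addQ plus  (plus ∷ s)  = s≤s z≤n
1≤length-addQ plus  (minus ∷ s) = s≤s z≤n
1≤length-addQ minus []          = s≤s z≤n
1≤length-addQ minus (plus ∷ s)  = s≤s z≤n
1≤length-addQ minus (minus ∷ s) = s≤s z≤n

length-addQ-swap : ∀ s → length (addQ plus (List.map swap s)) ≡ length (addQ minus s)
length-addQ-swap []          = refl
length-addQ-swap (plus ∷ s)  = cong suc (cong suc (length-map swap s))
length-addQ-swap (minus ∷ s) = cong suc (length-map swap s)

-- How long a path may be to sit inside a Σₙ (resp. Πₙ) quantifier prefix: a path that opens
-- with the other quantifier needs one more, outer block.
FitsΣ : ℕ → List Sym → Set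
FitsΣ n []          = ⊤
FitsΣ n (plus ∷ s)  = suc (length s) ≤ n
FitsΣ n (minus ∷ s) = suc (suc (length s)) ≤ n

FitsΠ : ℕ → List Sym → Set
FitsΠ n []          = ⊤
FitsΠ n (minus ∷ s) = suc (length s) ≤ n
FitsΠ n (plus ∷ s)  = suc (suc (length s)) ≤ n

FitsΣ-swap : ∀ {n} s → FitsΣ n (List.map swap s) → FitsΠ n s
FitsΣ-swap []          p = tt
FitsΣ-swap (plus ∷ s)  p rewrite length-map swap s = p
FitsΣ-swap (minus ∷ s) p rewrite length-map swap s = p

FitsΠ-swap : ∀ {n} s → FitsΠ n (List.map swap s) → FitsΣ n s
FitsΠ-swap []          p = tt
FitsΠ-swap (plus ∷ s)  p rewrite length-map swap s = p
FitsΠ-swap (minus ∷ s) p rewrite length-map swap s = p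

FitsΣ-∃ : ∀ {n} s → FitsΣ n (addQ plus s) → FitsΣ n s
FitsΣ-∃ []          p = tt
FitsΣ-∃ (plus ∷ s)  p = p
FitsΣ-∃ (minus ∷ s) p = p

FitsΠ-∀ : ∀ {n} s → FitsΠ n (addQ minus s) → FitsΠ n s
FitsΠ-∀ []          p = tt
FitsΠ-∀ (plus ∷ s)  p = p
FitsΠ-∀ (minus ∷ s) p = p

FitsΣ-∀ : ∀ {m} s → FitsΣ (suc m) (addQ minus s) → FitsΠ m s
FitsΣ-∀ []          p       = tt
FitsΣ-∀ (plus ∷ s)  (s≤s p) = p
FitsΣ-∀ (minus ∷ s) (s≤s p) = p

FitsΠ-∃ : ∀ {m} s → FitsΠ (suc m) (addQ plus s) → FitsΣ m s
FitsΠ-∃ []          p       = tt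
FitsΠ-∃ (plus ∷ s)  (s≤s p) = p
FitsΠ-∃ (minus ∷ s) (s≤s p) = p

FitsΣ-∃⇒1≤ : ∀ {n} → ∃ (FitsΣ n ∘ addQ plus) → 1 ≤ n
FitsΣ-∃⇒1≤ ([] , p)          = p
FitsΣ-∃⇒1≤ (plus ∷ s , p)    = ≤-trans (s≤s z≤n) p
FitsΣ-∃⇒1≤ (minus ∷ s , p)   = ≤-trans (s≤s z≤n) p

FitsΠ-∀⇒1≤ : ∀ {n} → ∃ (FitsΠ n ∘ addQ minus) → 1 ≤ n
FitsΠ-∀⇒1≤ ([] , p)          = p
FitsΠ-∀⇒1≤ (plus ∷ s , p)    = ≤-trans (s≤s z≤n) p
FitsΠ-∀⇒1≤ (minus ∷ s , p)   = ≤-trans (s≤s z≤n) p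

FitsΣ-∀⇒2≤ : ∀ {n} → ∃ (FitsΣ n ∘ addQ minus) → 2 ≤ n
FitsΣ-∀⇒2≤ ([] , p)          = p
FitsΣ-∀⇒2≤ (plus ∷ s , p)    = ≤-trans (s≤s (s≤s z≤n)) p
FitsΣ-∀⇒2≤ (minus ∷ s , p)   = ≤-trans (s≤s (s≤s z≤n)) p

FitsΠ-∃⇒2≤ : ∀ {n} → ∃ (FitsΠ n ∘ addQ plus) → 2 ≤ n
FitsΠ-∃⇒2≤ ([] , p)          = p
FitsΠ-∃⇒2≤ (plus ∷ s , p)    = ≤-trans (s≤s (s≤s z≤n)) p
FitsΠ-∃⇒2≤ (minus ∷ s , p)   = ≤-trans (s≤s (s≤s z≤n)) p

FitsΠ-addQ-minus : ∀ {k} s → length (addQ minus s) ≤ k → FitsΠ k (addQ minus s)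
FitsΠ-addQ-minus []          p = p
FitsΠ-addQ-minus (plus ∷ s)  p = p
FitsΠ-addQ-minus (minus ∷ s) p = p

FitsΣ-addQ-plus : ∀ {k} s → length (addQ plus s) ≤ k → FitsΣ k (addQ plus s)
FitsΣ-addQ-plus []          p = p
FitsΣ-addQ-plus (plus ∷ s)  p = p
FitsΣ-addQ-plus (minus ∷ s) p = p

AllPaths≤-⇒⁻ : ∀ {k} B C → AllPaths≤ k (B ⇒ C) → AllPaths≤ k B × AllPaths≤ k C
AllPaths≤-⇒⁻ {k} B C al =
  let aB , aC = All-Alt-⇒⁻ z≤n B C al in All.map (λ {s} → subst (_≤ k) (length-map swap s)) aB , aC

AllPaths≤-∀⁻ : ∀ {k} B → AllPaths≤ k (∀' B) → AllPaths≤ k B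
AllPaths≤-∀⁻ B al = All.map (λ {s} → ≤-trans (length-addQ minus s)) (map⁻ al)

AllPaths≤-∃⁻ : ∀ {k} B → AllPaths≤ k (∃' B) → AllPaths≤ k B
AllPaths≤-∃⁻ B al = All.map (λ {s} → ≤-trans (length-addQ plus s)) (map⁻ al)

AllPaths≤-∃¬ : ∀ {k} B → AllPaths≤ k (∀' B) → AllPaths≤ k (∃' (¬' B))
AllPaths≤-∃¬ {k} B al =
  map⁺ (All-Alt-⇒⁺ 1≤k B ⊥' (All.map (λ {s} → subst (_≤ k) (sym (length-addQ-swap s))) (map⁻ al)) (1≤k ∷ []))
  where
  1≤k : 1 ≤ k
  1≤k = let s , p = All-Alt⇒∃ B (map⁻ al) in ≤-trans (1≤length-addQ minus s) p

QF-renF : ∀ ρ A → QF A → QF (renF ρ A)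
QF-renF ρ A q = trans (isQF-renF ρ A) q

F⁺-renF : ∀ {k} ρ A → F⁺ k A → F⁺ k (renF ρ A)
F⁺-renF {k} ρ A = subst (λ l → List.foldr _⊔_ 0 (List.map length l) ≤ k) (sym (Alt-renF ρ A))

mutual
  R-renF : ∀ {k A} ρ → R k A → R k (renF ρ A)
  R-renF ρ (r0 {φ} q)      = r0 (QF-renF ρ φ q)
  R-renF ρ (rF {φ = φ} f)  = rF (F⁺-renF ρ φ f)
  R-renF ρ (r∧ a b)        = r∧ (R-renF ρ a) (R-renF ρ b)
  R-renF ρ (r∨ a b)        = r∨ (R-renF ρ a) (R-renF ρ b)
  R-renF ρ (r∀ a)          = r∀ (R-renF (liftR ρ) a)
  R-renF ρ (r⇒ a b)        = r⇒ (J-renF ρ a) (R-renF ρ b)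

  J-renF : ∀ {k A} ρ → J k A → J k (renF ρ A)
  J-renF ρ (j0 {φ} q)      = j0 (QF-renF ρ φ q)
  J-renF ρ (jF {φ = φ} f)  = jF (F⁺-renF ρ φ f)
  J-renF ρ (j∧ a b)        = j∧ (J-renF ρ a) (J-renF ρ b)
  J-renF ρ (j∨ a b)        = j∨ (J-renF ρ a) (J-renF ρ b)
  J-renF ρ (j∃ a)          = j∃ (J-renF (liftR ρ) a)
  J-renF ρ (j⇒ a b)        = j⇒ (R-renF ρ a) (J-renF ρ b)

Q-renF : ∀ {k A} ρ → Q k A → Q k (renF ρ A)
Q-renF ρ (q0 {φ} q)       = q0 (QF-renF ρ φ q)
Q-renF ρ (qP (p≐ t s))    = qP (p≐ _ _)
Q-renF ρ (qP p⊥)          = qP p⊥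
Q-renF ρ (q∧ a b)         = q∧ (Q-renF ρ a) (Q-renF ρ b)
Q-renF ρ (q∨ a b)         = q∨ (Q-renF ρ a) (Q-renF ρ b)
Q-renF ρ (q∀ a)           = q∀ (Q-renF (liftR ρ) a)
Q-renF ρ (q∃ a)           = q∃ (Q-renF (liftR ρ) a)
Q-renF ρ (q⇒ a b)         = q⇒ (J-renF ρ a) (Q-renF ρ b)

mutual
  Sig-renF : ∀ {n A} ρ → Sig n A → Sig n (renF ρ A)
  Sig-renF ρ (sig0 {φ} q) = sig0 (QF-renF ρ φ q)
  Sig-renF ρ (sigB p)     = sigB (Pi-renF ρ p)
  Sig-renF ρ (sig∃ s)     = sig∃ (Sig-renF (liftR ρ) s)

  Pi-renF : ∀ {n A} ρ → Pi n A → Pi n (renF ρ A)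
  Pi-renF ρ (pi0 {φ} q)   = pi0 (QF-renF ρ φ q)
  Pi-renF ρ (piB s)       = piB (Sig-renF ρ s)
  Pi-renF ρ (pi∀ p)       = pi∀ (Pi-renF (liftR ρ) p)

mutual
  Sig-suc : ∀ {n A} → Sig n A → Sig (suc n) A
  Sig-suc (sig0 q) = sigB (pi0 q)
  Sig-suc (sigB p) = sigB (Pi-suc p)
  Sig-suc (sig∃ s) = sig∃ (Sig-suc s)

  Pi-suc : ∀ {n A} → Pi n A → Pi (suc n) A
  Pi-suc (pi0 q) = piB (sig0 q)
  Pi-suc (piB s) = piB (Sig-suc s)
  Pi-suc (pi∀ p) = pi∀ (Pi-suc p)

mutual
  Sig-mono : ∀ {m n A} → m ≤ n → Sig m A → Sig n A
  Sig-mono {zero} {zero}  z≤n     s        = s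
  Sig-mono {zero} {suc n} z≤n     s        = Sig-suc (Sig-mono z≤n s)
  Sig-mono                (s≤s p) (sigB q) = sigB (Pi-mono p q)
  Sig-mono                (s≤s p) (sig∃ s) = sig∃ (Sig-mono (s≤s p) s)

  Pi-mono : ∀ {m n A} → m ≤ n → Pi m A → Pi n A
  Pi-mono {zero} {zero}  z≤n     q        = q
  Pi-mono {zero} {suc n} z≤n     q        = Pi-suc (Pi-mono z≤n q)
  Pi-mono                (s≤s p) (piB s)  = piB (Sig-mono p s)
  Pi-mono                (s≤s p) (pi∀ q)  = pi∀ (Pi-mono (s≤s p) q)

QF⇒Sig : ∀ n {A} → QF A → Sig n A
QF⇒Sig n q = Sig-mono z≤n (sig0 q)

QF⇒Pi : ∀ n {A} → QF A → Pi n A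
QF⇒Pi n q = Pi-mono z≤n (pi0 q)

module Theory (T : Form → Set) where

  infix 2 _⊢_
  _⊢_ : List Form → Form → Set
  Γ ⊢ A = Γ ⊢[ T ] A

  infix 3 _⟶_ _⟷_
  _⟶_ : Form → Form → Set
  A ⟶ B = A ⟶⟨ T ⟩ B

  _⟷_ : Form → Form → Set
  A ⟷ B = (A ⟶ B) × (B ⟶ A)

  ⟷-refl : ∀ {A} → A ⟷ A
  ⟷-refl = ⟶-refl , ⟶-refl

  ⟷-sym : ∀ {A B} → A ⟷ B → B ⟷ A
  ⟷-sym (i , j) = j , i

  ⟷-trans : ∀ {A B C} → A ⟷ B → B ⟷ C → A ⟷ C
  ⟷-trans (i , j) (i′ , j′) = ⟶-trans i i′ , ⟶-trans j′ j

  ∧-cong : ∀ {A A′ B B′} → A ⟷ A′ → B ⟷ B′ → (A ∧' B) ⟷ (A′ ∧' B′)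
  ∧-cong (i , j) (i′ , j′) = ∧-mono i i′ , ∧-mono j j′

  ∨-cong : ∀ {A A′ B B′} → A ⟷ A′ → B ⟷ B′ → (A ∨' B) ⟷ (A′ ∨' B′)
  ∨-cong (i , j) (i′ , j′) = ∨-mono i i′ , ∨-mono j j′

  ⇒-cong : ∀ {A A′ B B′} → A ⟷ A′ → B ⟷ B′ → (A ⇒ B) ⟷ (A′ ⇒ B′)
  ⇒-cong (i , j) (i′ , j′) = ⇒-mono j i′ , ⇒-mono i j′

  ¬-cong : ∀ {A A′} → A ⟷ A′ → ¬' A ⟷ ¬' A′
  ¬-cong e = ⇒-cong e ⟷-refl

  ∀-cong : ∀ {A A′} → A ⟷ A′ → ∀' A ⟷ ∀' A′
  ∀-cong (i , j) = ∀-mono i , ∀-mono j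

  ∃-cong : ∀ {A A′} → A ⟷ A′ → ∃' A ⟷ ∃' A′
  ∃-cong (i , j) = ∃-mono i , ∃-mono j

  Decided : Form → Set
  Decided A = ∀ {Γ} → Γ ⊢ A ∨' ¬' A

  Stable : Form → Set
  Stable A = ¬' ¬' A ⟶ A

  Decided⇒Stable : ∀ {A} → Decided A → Stable A
  Decided⇒Stable d = ⇒I (∨E d #0 (⊥E (⇒E #1 #0)))

  Decided-⟷ : ∀ {A B} → A ⟷ B → Decided A → Decided B
  Decided-⟷ (i , j) d = ∨E d (∨I₁ (⇒E i #0)) (∨I₂ (⇒I (⇒E #1 (⇒E j #0))))

  Decided-∧ : ∀ {A B} → Decided A → Decided B → Decided (A ∧' B)
  Decided-∧ dA dB = ∨E dA (∨E dB (∨I₁ (∧I #1 #0)) (∨I₂ (⇒I (⇒E #1 (∧E₂ #0))))) (∨I₂ (⇒I (⇒E #1 (∧E₁ #0))))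

  Decided-∨ : ∀ {A B} → Decided A → Decided B → Decided (A ∨' B)
  Decided-∨ dA dB = ∨E dA (∨I₁ (∨I₁ #0)) (∨E dB (∨I₁ (∨I₂ #0)) (∨I₂ (⇒I (∨E #0 (⇒E #3 #0) (⇒E #2 #0)))))

  Decided-⇒ : ∀ {A B} → Decided A → Decided B → Decided (A ⇒ B)
  Decided-⇒ dA dB = ∨E dA (∨E dB (∨I₁ (⇒I #1)) (∨I₂ (⇒I (⇒E #1 (⇒E #0 #2))))) (∨I₁ (⇒I (⊥E (⇒E #1 #0))))

  record HasPrenex (Cl : ℕ → Form → Set) (n : ℕ) (A : Form) : Set where
    constructor prenex
    field
      form   : Form
      class  : Cl n form
      equiv  : A ⟷ form

  HasPrenex-⟷ : ∀ {Cl n A B} → A ⟷ B → HasPrenex Cl n B → HasPrenex Cl n A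
  HasPrenex-⟷ e (prenex U u e′) = prenex U u (⟷-trans e e′)

  ∃-∧-pullˡ : ∀ {A B} → (∃' A ∧' B) ⟷ ∃' (A ∧' ↑ B)
  ∃-∧-pullˡ = ⇒I (∃E (∧E₁ #0) (∃I-var0 (∧I #0 (∧E₂ #1)))) , ⇒I (∃E #0 (∧I (∃I-var0 (∧E₁ #0)) (∧E₂ #0)))

  ∃-∧-pullʳ : ∀ {A B} → (A ∧' ∃' B) ⟷ ∃' (↑ A ∧' B)
  ∃-∧-pullʳ = ⇒I (∃E (∧E₂ #0) (∃I-var0 (∧I (∧E₁ #1) #0))) , ⇒I (∃E #0 (∧I (∧E₁ #0) (∃I-var0 (∧E₂ #0))))

  ∀-∧-pullˡ : ∀ {A B} → (∀' A ∧' B) ⟷ ∀' (A ∧' ↑ B)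
  ∀-∧-pullˡ {B = B} = ⇒I (∀I (∧I (∀E-var0 (∧E₁ #0)) (∧E₂ #0))) ,
                      ⇒I (∧I (∀I (∧E₁ (∀E-var0 #0))) (cast (↑-[] B zero') (∧E₂ (∀E zero' #0))))

  ∀-∧-pullʳ : ∀ {A B} → (A ∧' ∀' B) ⟷ ∀' (↑ A ∧' B)
  ∀-∧-pullʳ {A = A} = ⇒I (∀I (∧I (∧E₁ #0) (∀E-var0 (∧E₂ #0)))) ,
                      ⇒I (∧I (cast (↑-[] A zero') (∧E₁ (∀E zero' #0))) (∀I (∧E₂ (∀E-var0 #0))))

  mutual
    Sig-∧ : ∀ {n A B} → Sig n A → Sig n B → HasPrenex Sig n (A ∧' B)
    Sig-∧ (sig0 {φ} q) (sig0 {ψ} q′) = prenex (φ ∧' ψ) (sig0 (cong₂ _∧_ q q′)) ⟷-refl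
    Sig-∧ (sig∃ a) b =
      let prenex U u e = Sig-∧ a (Sig-renF suc b)
      in prenex (∃' U) (sig∃ u) (⟷-trans ∃-∧-pullˡ (∃-cong e))
    Sig-∧ (sigB a) b = Pi∧Sig a b

    Pi∧Sig : ∀ {n A B} → Pi n A → Sig (suc n) B → HasPrenex Sig (suc n) (A ∧' B)
    Pi∧Sig a (sigB b) = let prenex U u e = Pi-∧ a b in prenex U (sigB u) e
    Pi∧Sig a (sig∃ b) =
      let prenex U u e = Pi∧Sig (Pi-renF suc a) b
      in prenex (∃' U) (sig∃ u) (⟷-trans ∃-∧-pullʳ (∃-cong e))

    Pi-∧ : ∀ {n A B} → Pi n A → Pi n B → HasPrenex Pi n (A ∧' B)
    Pi-∧ (pi0 {φ} q) (pi0 {ψ} q′) = prenex (φ ∧' ψ) (pi0 (cong₂ _∧_ q q′)) ⟷-refl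
    Pi-∧ (pi∀ a) b =
      let prenex U u e = Pi-∧ a (Pi-renF suc b)
      in prenex (∀' U) (pi∀ u) (⟷-trans ∀-∧-pullˡ (∀-cong e))
    Pi-∧ (piB a) b = Sig∧Pi a b

    Sig∧Pi : ∀ {n A B} → Sig n A → Pi (suc n) B → HasPrenex Pi (suc n) (A ∧' B)
    Sig∧Pi a (piB b) = let prenex U u e = Sig-∧ a b in prenex U (piB u) e
    Sig∧Pi a (pi∀ b) =
      let prenex U u e = Sig∧Pi (Sig-renF suc a) b
      in prenex (∀' U) (pi∀ u) (⟷-trans ∀-∧-pullʳ (∀-cong e))

-- Q-, J- and R-formulas are built so as to have, respectively, the three properties below.
module Translation (T : Form → Set) where

  open Theory T

  Into⟦⟧ : Form → Set
  Into⟦⟧ A = ∀ {D} → A ⟶ ⟦ A ⟧[ D ]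

  OutOf⟦⟧ : Form → Set
  OutOf⟦⟧ A = ∀ {D} → ⟦ A ⟧[ D ] ⟶ ((A ⇒ D) ⇒ D)

  NegInto⟦⟧ : Form → Set
  NegInto⟦⟧ A = ∀ {D} → (¬' A ⇒ D) ⟶ ⟦ A ⟧[ D ]

  Into⟦⟧-≐ : ∀ t s → Into⟦⟧ (t ≐ s)
  Into⟦⟧-≐ t s = ⇒I (⇒I (⇒E #0 #1))

  Into⟦⟧-⊥ : Into⟦⟧ ⊥'
  Into⟦⟧-⊥ = ⇒I (⊥E #0)

  Into⟦⟧-∨ : ∀ {A B} → Into⟦⟧ A → Into⟦⟧ B → Into⟦⟧ (A ∨' B)
  Into⟦⟧-∨ a b = ⇒I (⇒I (∨E #1 (⇒E (∧E₁ #1) (⇒E a #0)) (⇒E (∧E₂ #1) (⇒E b #0))))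

  Into⟦⟧-⇒ : ∀ {A B} → OutOf⟦⟧ A → Into⟦⟧ B → Into⟦⟧ (A ⇒ B)
  Into⟦⟧-⇒ {B = B} a b = ⇒I (⇒I (⇒E (⟦⟧-stable B) (⇒I (⇒E (⇒E a #1) (⇒I (⇒E #1 (⇒E b (⇒E #3 #0))))))))

  Into⟦⟧-∃ : ∀ {A} → Into⟦⟧ A → Into⟦⟧ (∃' A)
  Into⟦⟧-∃ a = ⇒I (⇒I (∃E #1 (⇒E (∀E-var0 #1) (⇒E a #0))))

  OutOf⟦⟧-≐ : ∀ t s → OutOf⟦⟧ (t ≐ s)
  OutOf⟦⟧-≐ t s = ⇒I (⇒I (⇒E #1 #0))

  OutOf⟦⟧-⊥ : OutOf⟦⟧ ⊥'
  OutOf⟦⟧-⊥ = ⇒I (⇒I #1)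

  OutOf⟦⟧-∧ : ∀ {A B} → OutOf⟦⟧ A → OutOf⟦⟧ B → OutOf⟦⟧ (A ∧' B)
  OutOf⟦⟧-∧ a b = ⇒I (⇒I (⇒E (⇒E a (∧E₁ #1)) (⇒I (⇒E (⇒E b (∧E₂ #2)) (⇒I (⇒E #2 (∧I #1 #0)))))))

  OutOf⟦⟧-∨ : ∀ {A B} → OutOf⟦⟧ A → OutOf⟦⟧ B → OutOf⟦⟧ (A ∨' B)
  OutOf⟦⟧-∨ a b = ⇒I (⇒I (⇒E #1 (∧I (⇒I (⇒E (⇒E a #0) (⇒I (⇒E #2 (∨I₁ #0)))))
                                    (⇒I (⇒E (⇒E b #0) (⇒I (⇒E #2 (∨I₂ #0))))))))

  OutOf⟦⟧-⇒ : ∀ {A B} → NegInto⟦⟧ A → OutOf⟦⟧ B → OutOf⟦⟧ (A ⇒ B)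
  OutOf⟦⟧-⇒ a b = ⇒I (⇒I (⇒E (⇒E b (⇒E #1 (⇒E a (⇒I (⇒E #1 (⇒I (⊥E (⇒E #1 #0))))))))
                             (⇒I (⇒E #1 (⇒I #1)))))

  -- If ∃x ¬A holds, its witness refutes A; otherwise A holds for every x.
  OutOf⟦⟧-∀ : ∀ {A} → Decided (∃' (¬' A)) → Decided A → OutOf⟦⟧ A → OutOf⟦⟧ (∀' A)
  OutOf⟦⟧-∀ d∃¬ d a = ⇒I (⇒I (∨E d∃¬ (∃E #0 (⇒E (⇒E a (∀E-var0 #3)) (⇒I (⊥E (⇒E #1 #0)))))
                                        (⇒E #1 (∀I (∨E d #0 (⊥E (⇒E #1 (∃I-var0 #0))))))))

  OutOf⟦⟧-∃ : ∀ {A} → OutOf⟦⟧ A → OutOf⟦⟧ (∃' A)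
  OutOf⟦⟧-∃ a = ⇒I (⇒I (⇒E #1 (∀I (⇒I (⇒E (⇒E a #0) (⇒I (⇒E #2 (∃I-var0 #0))))))))

  Decided⇒NegInto⟦⟧ : ∀ {A} → Decided A → Into⟦⟧ A → NegInto⟦⟧ A
  Decided⇒NegInto⟦⟧ {A} d a = ⇒I (∨E d (⇒E a #0) (⇒E (D⟶⟦⟧ A) (⇒E #1 #0)))

  NegInto⟦⟧-∧ : ∀ {A B} → NegInto⟦⟧ A → NegInto⟦⟧ B → NegInto⟦⟧ (A ∧' B)
  NegInto⟦⟧-∧ a b = ⇒I (∧I (⇒E a (⇒I (⇒E #1 (⇒I (⇒E #1 (∧E₁ #0))))))
                           (⇒E b (⇒I (⇒E #1 (⇒I (⇒E #1 (∧E₂ #0)))))))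

  NegInto⟦⟧-∨ : ∀ {A B} → NegInto⟦⟧ A → NegInto⟦⟧ B → NegInto⟦⟧ (A ∨' B)
  NegInto⟦⟧-∨ a b = ⇒I (⇒I (⇒E (∧E₁ #0) (⇒E a (⇒I (⇒E (∧E₂ #1) (⇒E b
                      (⇒I (⇒E #3 (⇒I (∨E #0 (⇒E #3 #0) (⇒E #2 #0)))))))))))

  NegInto⟦⟧-⇒ : ∀ {A B} → OutOf⟦⟧ A → NegInto⟦⟧ B → NegInto⟦⟧ (A ⇒ B)
  NegInto⟦⟧-⇒ a b = ⇒I (⇒I (⇒E b (⇒I (⇒E (⇒E a #1) (⇒I (⇒E #3 (⇒I (⇒E #2 (⇒E #0 #1)))))))))

  NegInto⟦⟧-∀ : ∀ {A} → NegInto⟦⟧ A → NegInto⟦⟧ (∀' A)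
  NegInto⟦⟧-∀ a = ⇒I (∀I (⇒E a (⇒I (⇒E #1 (⇒I (⇒E #1 (∀E-var0 #0)))))))

module HA+X+LEM (X : Form → Set) (k : ℕ) where

  open Theory (HAXLEM X k) public
  open Translation (HAXLEM X k) public

  Sig-decided : ∀ {n A} → n ≤ k → Sig n A → Decided A
  Sig-decided le s = ax (lem (Sig-mono le s))

  Pi-stable : ∀ {n A} → n ≤ k → Pi n A → Stable A
  Pi-stable le       (pi0 q) = Decided⇒Stable (Sig-decided le (sig0 q))
  Pi-stable (s≤s le) (piB s) = Decided⇒Stable (Sig-decided (≤-trans le (n≤1+n _)) s)
  Pi-stable le       (pi∀ p) = ⇒I (∀I (⇒E (Pi-stable le p) (⇒I (⇒E #1 (⇒I (⇒E #1 (∀E-var0 #0)))))))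

  ¬∃⟷∀¬ : ∀ {A} → ¬' ∃' A ⟷ ∀' (¬' A)
  ¬∃⟷∀¬ = ⇒I (∀I (⇒I (⇒E #1 (∃I-var0 #0)))) , ⇒I (⇒I (∃E #0 (⇒E (∀E-var0 #2) #0)))

  mutual
    ¬-Sig : ∀ {n A} → n ≤ k → Sig n A → HasPrenex Pi n (¬' A)
    ¬-Sig le       (sig0 {φ} q) = prenex (¬' φ) (pi0 (cong (_∧ true) q)) ⟷-refl
    ¬-Sig (s≤s le) (sigB p)     = let prenex U u e = ¬-Pi (≤-trans le (n≤1+n _)) p in prenex U (piB u) e
    ¬-Sig le       (sig∃ s)     =
      let prenex U u e = ¬-Sig le s
      in prenex (∀' U) (pi∀ u) (⟷-trans ¬∃⟷∀¬ (∀-cong e))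

    -- ¬∀x A ⇒ ∃x ¬A: decide the Σₙ formula ∃x ¬A; if it fails, A holds everywhere by stability.
    ¬-Pi : ∀ {n A} → n ≤ k → Pi n A → HasPrenex Sig n (¬' A)
    ¬-Pi le       (pi0 {φ} q) = prenex (¬' φ) (sig0 (cong (_∧ true) q)) ⟷-refl
    ¬-Pi (s≤s le) (piB s)     = let prenex U u e = ¬-Sig (≤-trans le (n≤1+n _)) s in prenex U (sigB u) e
    ¬-Pi le       (pi∀ p)     =
      let prenex U u (i , j) = ¬-Pi le p in
      prenex (∃' U) (sig∃ u)
      ( ⇒I (∨E (Sig-decided le (sig∃ u)) #0
               (⊥E (⇒E #1 (∀I (⇒E (Pi-stable le p) (⇒I (⇒E #1 (∃I-var0 (⇒E i #0))))))))) ,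
        ⇒I (⇒I (∃E #1 (⇒E (⇒E j #0) (∀E-var0 #1)))))

  Pi-decided : ∀ {n A} → n ≤ k → Pi n A → Decided A
  Pi-decided le p =
    let prenex S s (i , j) = ¬-Pi le p in
    ∨E (Sig-decided le s) (∨I₂ (⇒E j #0)) (∨I₁ (⇒E (Pi-stable le p) (⇒I (⇒E #1 (⇒E i #0)))))

  ∨⟷¬∧¬ : ∀ {A B} → Decided A → Stable B → (A ∨' B) ⟷ ¬' (¬' A ∧' ¬' B)
  ∨⟷¬∧¬ dA sB = ⇒I (⇒I (∨E #1 (⇒E (∧E₁ #1) #0) (⇒E (∧E₂ #1) #0))) ,
                ⇒I (∨E dA (∨I₁ #0) (∨I₂ (⇒E sB (⇒I (⇒E #2 (∧I #1 #0))))))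

  ⇒⟷¬∧¬ : ∀ {A B} → Stable B → (A ⇒ B) ⟷ ¬' (A ∧' ¬' B)
  ⇒⟷¬∧¬ sB = ⇒I (⇒I (⇒E (∧E₂ #0) (⇒E #1 (∧E₁ #0)))) ,
             ⇒I (⇒I (⇒E sB (⇒I (⇒E #2 (∧I #1 #0)))))

  ¬-Pi-∧ : ∀ {n A B} → n ≤ k → Pi n A → Pi n B → HasPrenex Sig n (¬' (A ∧' B))
  ¬-Pi-∧ le a b = let prenex U u e = Pi-∧ a b in HasPrenex-⟷ (¬-cong e) (¬-Pi le u)

  ¬-Sig-∧ : ∀ {n A B} → n ≤ k → Sig n A → Sig n B → HasPrenex Pi n (¬' (A ∧' B))
  ¬-Sig-∧ le a b = let prenex U u e = Sig-∧ a b in HasPrenex-⟷ (¬-cong e) (¬-Sig le u)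

  Sig-∨ : ∀ {n A B} → n ≤ k → Sig n A → Sig n B → HasPrenex Sig n (A ∨' B)
  Sig-∨ le a b =
    let prenex _ a′ e = ¬-Sig le a ; prenex _ b′ e′ = ¬-Sig le b in
    HasPrenex-⟷ (⟷-trans (∨⟷¬∧¬ (Sig-decided le a) (Decided⇒Stable (Sig-decided le b))) (¬-cong (∧-cong e e′)))
                (¬-Pi-∧ le a′ b′)

  Pi-∨ : ∀ {n A B} → n ≤ k → Pi n A → Pi n B → HasPrenex Pi n (A ∨' B)
  Pi-∨ le a b =
    let prenex _ a′ e = ¬-Pi le a ; prenex _ b′ e′ = ¬-Pi le b in
    HasPrenex-⟷ (⟷-trans (∨⟷¬∧¬ (Pi-decided le a) (Pi-stable le b)) (¬-cong (∧-cong e e′)))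
                (¬-Sig-∧ le a′ b′)

  Pi⇒Sig : ∀ {n A B} → n ≤ k → Pi n A → Sig n B → HasPrenex Sig n (A ⇒ B)
  Pi⇒Sig le a b =
    let prenex _ b′ e = ¬-Sig le b in
    HasPrenex-⟷ (⟷-trans (⇒⟷¬∧¬ (Decided⇒Stable (Sig-decided le b))) (¬-cong (∧-cong ⟷-refl e)))
                (¬-Pi-∧ le a b′)

  Sig⇒Pi : ∀ {n A B} → n ≤ k → Sig n A → Pi n B → HasPrenex Pi n (A ⇒ B)
  Sig⇒Pi le a b =
    let prenex _ b′ e = ¬-Pi le b in
    HasPrenex-⟷ (⟷-trans (⇒⟷¬∧¬ (Pi-stable le b)) (¬-cong (∧-cong ⟷-refl e)))
                (¬-Sig-∧ le a b′)

  mutual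
    prenexΣ : ∀ {n} A → n ≤ k → All (FitsΣ n) (Alt A) → HasPrenex Sig n A
    prenexΣ {n} (t ≐ s) _ _ = prenex (t ≐ s) (QF⇒Sig n refl) ⟷-refl
    prenexΣ {n} ⊥'      _ _ = prenex ⊥' (QF⇒Sig n refl) ⟷-refl
    prenexΣ (B ∧' C) le al =
      let aB , aC = All-Alt-∧⁻ tt B C al ; prenex _ b eB = prenexΣ B le aB ; prenex _ c eC = prenexΣ C le aC
      in HasPrenex-⟷ (∧-cong eB eC) (Sig-∧ b c)
    prenexΣ (B ∨' C) le al =
      let aB , aC = All-Alt-∨⁻ tt B C al ; prenex _ b eB = prenexΣ B le aB ; prenex _ c eC = prenexΣ C le aC
      in HasPrenex-⟷ (∨-cong eB eC) (Sig-∨ le b c)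
    prenexΣ (B ⇒ C) le al =
      let aB , aC = All-Alt-⇒⁻ tt B C al
          prenex _ b eB = prenexΠ B le (All.map (FitsΣ-swap _) aB) ; prenex _ c eC = prenexΣ C le aC
      in HasPrenex-⟷ (⇒-cong eB eC) (Pi⇒Sig le b c)
    prenexΣ {zero}        (∀' B) _  al = contradiction (FitsΣ-∀⇒2≤ (All-Alt⇒∃ B (map⁻ al))) λ ()
    prenexΣ {suc zero}    (∀' B) _  al = contradiction (FitsΣ-∀⇒2≤ (All-Alt⇒∃ B (map⁻ al))) λ { (s≤s ()) }
    prenexΣ {suc (suc n)} (∀' B) le al =
      let prenex P p e = prenexΠ B (≤-trans (n≤1+n _) le) (All.map (FitsΣ-∀ _) (map⁻ al))
      in prenex (∀' P) (sigB (pi∀ p)) (∀-cong e)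
    prenexΣ {zero}        (∃' B) _  al = contradiction (FitsΣ-∃⇒1≤ (All-Alt⇒∃ B (map⁻ al))) λ ()
    prenexΣ {suc n}       (∃' B) le al =
      let prenex S s e = prenexΣ B le (All.map (FitsΣ-∃ _) (map⁻ al)) in prenex (∃' S) (sig∃ s) (∃-cong e)

    prenexΠ : ∀ {n} A → n ≤ k → All (FitsΠ n) (Alt A) → HasPrenex Pi n A
    prenexΠ {n} (t ≐ s) _ _ = prenex (t ≐ s) (QF⇒Pi n refl) ⟷-refl
    prenexΠ {n} ⊥'      _ _ = prenex ⊥' (QF⇒Pi n refl) ⟷-refl
    prenexΠ (B ∧' C) le al =
      let aB , aC = All-Alt-∧⁻ tt B C al ; prenex _ b eB = prenexΠ B le aB ; prenex _ c eC = prenexΠ C le aC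
      in HasPrenex-⟷ (∧-cong eB eC) (Pi-∧ b c)
    prenexΠ (B ∨' C) le al =
      let aB , aC = All-Alt-∨⁻ tt B C al ; prenex _ b eB = prenexΠ B le aB ; prenex _ c eC = prenexΠ C le aC
      in HasPrenex-⟷ (∨-cong eB eC) (Pi-∨ le b c)
    prenexΠ (B ⇒ C) le al =
      let aB , aC = All-Alt-⇒⁻ tt B C al
          prenex _ b eB = prenexΣ B le (All.map (FitsΠ-swap _) aB) ; prenex _ c eC = prenexΠ C le aC
      in HasPrenex-⟷ (⇒-cong eB eC) (Sig⇒Pi le b c)
    prenexΠ {zero}        (∀' B) _  al = contradiction (FitsΠ-∀⇒1≤ (All-Alt⇒∃ B (map⁻ al))) λ ()
    prenexΠ {suc n}       (∀' B) le al =
      let prenex P p e = prenexΠ B le (All.map (FitsΠ-∀ _) (map⁻ al)) in prenex (∀' P) (pi∀ p) (∀-cong e)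
    prenexΠ {zero}        (∃' B) _  al = contradiction (FitsΠ-∃⇒2≤ (All-Alt⇒∃ B (map⁻ al))) λ ()
    prenexΠ {suc zero}    (∃' B) _  al = contradiction (FitsΠ-∃⇒2≤ (All-Alt⇒∃ B (map⁻ al))) λ { (s≤s ()) }
    prenexΠ {suc (suc n)} (∃' B) le al =
      let prenex S s e = prenexΣ B (≤-trans (n≤1+n _) le) (All.map (FitsΠ-∃ _) (map⁻ al))
      in prenex (∃' S) (piB (sig∃ s)) (∃-cong e)

  F⁺-decided : ∀ A → AllPaths≤ k A → Decided A
  F⁺-decided (t ≐ s) _ = Sig-decided z≤n (sig0 refl)
  F⁺-decided ⊥'      _ = Sig-decided z≤n (sig0 refl)
  F⁺-decided (B ∧' C) al =
    let aB , aC = All-Alt-∧⁻ z≤n B C al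
    in Decided-∧ (F⁺-decided B aB) (F⁺-decided C aC)
  F⁺-decided (B ∨' C) al =
    let aB , aC = All-Alt-∨⁻ z≤n B C al
    in Decided-∨ (F⁺-decided B aB) (F⁺-decided C aC)
  F⁺-decided (B ⇒ C)  al = let aB , aC = AllPaths≤-⇒⁻ B C al in Decided-⇒ (F⁺-decided B aB) (F⁺-decided C aC)
  F⁺-decided (∀' B) al =
    let prenex _ p e = prenexΠ (∀' B) ≤-refl (map⁺ (All.map (λ {s} → FitsΠ-addQ-minus s) (map⁻ al)))
    in Decided-⟷ (⟷-sym e) (Pi-decided ≤-refl p)
  F⁺-decided (∃' B) al =
    let prenex _ s e = prenexΣ (∃' B) ≤-refl (map⁺ (All.map (λ {s} → FitsΣ-addQ-plus s) (map⁻ al)))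
    in Decided-⟷ (⟷-sym e) (Sig-decided ≤-refl s)

  mutual
    F⁺-Into⟦⟧ : ∀ A → AllPaths≤ k A → Into⟦⟧ A
    F⁺-Into⟦⟧ (t ≐ s)  _  = Into⟦⟧-≐ t s
    F⁺-Into⟦⟧ ⊥'       _  = Into⟦⟧-⊥
    F⁺-Into⟦⟧ (B ∧' C) al = let aB , aC = All-Alt-∧⁻ z≤n B C al in ∧-mono (F⁺-Into⟦⟧ B aB) (F⁺-Into⟦⟧ C aC)
    F⁺-Into⟦⟧ (B ∨' C) al = let aB , aC = All-Alt-∨⁻ z≤n B C al in Into⟦⟧-∨ (F⁺-Into⟦⟧ B aB) (F⁺-Into⟦⟧ C aC)
    F⁺-Into⟦⟧ (B ⇒ C)  al = let aB , aC = AllPaths≤-⇒⁻ B C al in Into⟦⟧-⇒ (F⁺-OutOf⟦⟧ B aB) (F⁺-Into⟦⟧ C aC)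
    F⁺-Into⟦⟧ (∀' B)   al = ∀-mono (F⁺-Into⟦⟧ B (AllPaths≤-∀⁻ B al))
    F⁺-Into⟦⟧ (∃' B)   al = Into⟦⟧-∃ (F⁺-Into⟦⟧ B (AllPaths≤-∃⁻ B al))

    F⁺-OutOf⟦⟧ : ∀ A → AllPaths≤ k A → OutOf⟦⟧ A
    F⁺-OutOf⟦⟧ (t ≐ s)  _  = OutOf⟦⟧-≐ t s
    F⁺-OutOf⟦⟧ ⊥'       _  = OutOf⟦⟧-⊥
    F⁺-OutOf⟦⟧ (B ∧' C) al =
      let aB , aC = All-Alt-∧⁻ z≤n B C al
      in OutOf⟦⟧-∧ (F⁺-OutOf⟦⟧ B aB) (F⁺-OutOf⟦⟧ C aC)
    F⁺-OutOf⟦⟧ (B ∨' C) al =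
      let aB , aC = All-Alt-∨⁻ z≤n B C al
      in OutOf⟦⟧-∨ (F⁺-OutOf⟦⟧ B aB) (F⁺-OutOf⟦⟧ C aC)
    F⁺-OutOf⟦⟧ (B ⇒ C)  al =
      let aB , aC = AllPaths≤-⇒⁻ B C al
      in OutOf⟦⟧-⇒ (Decided⇒NegInto⟦⟧ (F⁺-decided B aB) (F⁺-Into⟦⟧ B aB)) (F⁺-OutOf⟦⟧ C aC)
    F⁺-OutOf⟦⟧ (∀' B)   al =
      let aB = AllPaths≤-∀⁻ B al
      in OutOf⟦⟧-∀ (F⁺-decided (∃' (¬' B)) (AllPaths≤-∃¬ B al)) (F⁺-decided B aB) (F⁺-OutOf⟦⟧ B aB)
    F⁺-OutOf⟦⟧ (∃' B)   al = OutOf⟦⟧-∃ (F⁺-OutOf⟦⟧ B (AllPaths≤-∃⁻ B al))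

  mutual
    R⇒NegInto⟦⟧ : ∀ {A} → R (suc k) A → NegInto⟦⟧ A
    R⇒NegInto⟦⟧ (rF {φ = A} f) =
      let al = F⁺⇒AllPaths≤ A f
      in Decided⇒NegInto⟦⟧ (F⁺-decided A al) (F⁺-Into⟦⟧ A al)
    R⇒NegInto⟦⟧ (r∧ a b)       = NegInto⟦⟧-∧ (R⇒NegInto⟦⟧ a) (R⇒NegInto⟦⟧ b)
    R⇒NegInto⟦⟧ (r∨ a b)       = NegInto⟦⟧-∨ (R⇒NegInto⟦⟧ a) (R⇒NegInto⟦⟧ b)
    R⇒NegInto⟦⟧ (r∀ a)         = NegInto⟦⟧-∀ (R⇒NegInto⟦⟧ a)
    R⇒NegInto⟦⟧ (r⇒ a b)       = NegInto⟦⟧-⇒ (J⇒OutOf⟦⟧ a) (R⇒NegInto⟦⟧ b)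

    J⇒OutOf⟦⟧ : ∀ {A} → J (suc k) A → OutOf⟦⟧ A
    J⇒OutOf⟦⟧ (jF {φ = A} f) = F⁺-OutOf⟦⟧ A (F⁺⇒AllPaths≤ A f)
    J⇒OutOf⟦⟧ (j∧ a b)       = OutOf⟦⟧-∧ (J⇒OutOf⟦⟧ a) (J⇒OutOf⟦⟧ b)
    J⇒OutOf⟦⟧ (j∨ a b)       = OutOf⟦⟧-∨ (J⇒OutOf⟦⟧ a) (J⇒OutOf⟦⟧ b)
    J⇒OutOf⟦⟧ (j∃ a)         = OutOf⟦⟧-∃ (J⇒OutOf⟦⟧ a)
    J⇒OutOf⟦⟧ (j⇒ a b)       = OutOf⟦⟧-⇒ (R⇒NegInto⟦⟧ a) (J⇒OutOf⟦⟧ b)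

  Q⇒Into⟦⟧ : ∀ {A} → Q (suc k) A → Into⟦⟧ A
  Q⇒Into⟦⟧ (qP (p≐ t s)) = Into⟦⟧-≐ t s
  Q⇒Into⟦⟧ (qP p⊥)       = Into⟦⟧-⊥
  Q⇒Into⟦⟧ (q∧ a b)      = ∧-mono (Q⇒Into⟦⟧ a) (Q⇒Into⟦⟧ b)
  Q⇒Into⟦⟧ (q∨ a b)      = Into⟦⟧-∨ (Q⇒Into⟦⟧ a) (Q⇒Into⟦⟧ b)
  Q⇒Into⟦⟧ (q∀ a)        = ∀-mono (Q⇒Into⟦⟧ a)
  Q⇒Into⟦⟧ (q∃ a)        = Into⟦⟧-∃ (Q⇒Into⟦⟧ a)
  Q⇒Into⟦⟧ (q⇒ a b)      = Into⟦⟧-⇒ (J⇒OutOf⟦⟧ a) (Q⇒Into⟦⟧ b)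

  -- Translate the classical proof with D := φ: Q⇒Into⟦⟧ supplies the translations of the
  -- axioms of X and of the premise ψ, and J⇒OutOf⟦⟧ turns ⟦ φ ⟧[ φ ] back into φ.
  J-conservative : (∀ θ → X θ → Q (suc k) θ) → ∀ {φ ψ} → J (suc k) φ → Q (suc k) ψ →
                   [] ⊢[ PAX X ] ψ ⇒ φ → [] ⊢ ψ ⇒ φ
  J-conservative X-Q {φ} j q d =
    ⇒I (⇒E (⇒E (J⇒OutOf⟦⟧ j) (⇒E (wk₁ (⟦⟧-sound X⊢⟦⟧ d φ)) (⇒E (Q⇒Into⟦⟧ q) #0))) ⟶-refl)
    where
    X⊢⟦⟧ : ∀ {θ Γ} D → X θ → Γ ⊢ ⟦ θ ⟧[ D ]
    X⊢⟦⟧ {θ} D x = ⇒E (Q⇒Into⟦⟧ (X-Q θ x)) (ax (fromX x))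

corollary3p19 : (k : ℕ) (X : Form → Set) →
    (∀ θ → X θ → Sentence θ × Q (suc k) θ) →
    (φ ψ : Form) → V (suc k) φ → Q (suc k) ψ →
    [] ⊢[ PAX X ] (ψ ⇒ φ) →
    [] ⊢[ HAXLEM X k ] (ψ ⇒ φ)
corollary3p19 k X hX φ ψ (vJ j) q d = HA+X+LEM.J-conservative X k (λ θ x → proj₂ (hX θ x)) j q d
corollary3p19 k X hX (φ ∧' φ′) ψ (v∧ v v′) q d =
  ⇒-∧-intro (corollary3p19 k X hX φ ψ v q (⇒-∧-elim₁ d)) (corollary3p19 k X hX φ′ ψ v′ q (⇒-∧-elim₂ d))
corollary3p19 k X hX (∀' φ) ψ (v∀ v) q d =
  ⇒-∀-intro (corollary3p19 k X hX φ (↑ ψ) v (Q-renF suc q)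
    (⇒-∀-elim (⊢-renF (PAX-renF (λ θ x → proj₁ (hX θ x))) d suc)))
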